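{- Let $v\geq 4$ and let $D$ be a subset of the full design $F(v,3)$. Suppose there exist distinct $a,b\in N(v)$ such that $s_{a,b}(D)>\lfloor (4v-11)/3\rfloor$. Then $D$ is not a defining set for $F(v,3)$.
   Context: $N(v)=\{1,\dots,v\}$. A $(v,k,\lambda)$-design is a collection (repeated blocks allowed) of $k$-element subsets (blocks) of $N(v)$ such that each unordered pair of distinct elements of $N(v)$ lies in exactly $\lambda$ blocks. The full design $F(v,k)$ is the design consisting of all $k$-subsets of $N(v)$, each once; it is a $(v,k,\binom{v-2}{k-2})$-design. A subset $D\subseteq F(v,k)$ is a defining set for $F(v,k)$ if $F(v,k)$ is the only $(v,k,\binom{v-2}{k-2})$-design (repeated blocks allowed) containing $D$. For $D\subseteq F(v,3)$ and distinct $a,b\in N(v)$, $s_{a,b}(D)$ is the number of unordered pairs $\{i,j\}\subset N(v)\setminus\{a,b\}$ such that neither $\{i,j,a\}$ nor $\{i,j,b\}$ belongs to $D$. -}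

module Defs where

open import Data.Nat using (ℕ; zero; suc; _+_; _∸_; _≤_; _<_; _<?_)
open import Data.Nat.Combinatorics using (_C_)
open import Data.Bool using (Bool; true; false; if_then_else_; _∧_; not)
open import Data.Nat.ListAction using (sum)
open import Data.List using (List; []; _∷_; map; _++_; filter; length; concatMap)
open import Data.Fin using (Fin; toℕ; _≟_)
open import Data.Fin.Subset using (Subset; inside; outside; ⁅_⁆; _∪_; ∣_∣)
open import Data.Fin.Subset.Properties using (_∈?_)
open import Data.Vec using ([]; _∷_)
open import Data.List using (allFin)
open import Data.Product using (_×_; _,_)
open import Relation.Nullary.Decidable using (⌊_⌋; Dec)
open import Relation.Binary.PropositionalEquality using (_≡_; _≢_)

-- Points of N(v) are represented by Fin v; a block / subset of N(v) by Subset v.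

allSubsets : (n : ℕ) → List (Subset n)
allSubsets zero    = [] ∷ []
allSubsets (suc n) = map (outside ∷_) (allSubsets n) ++ map (inside ∷_) (allSubsets n)

-- A design on N(v) with repeated blocks allowed is given by its multiplicity
-- function  m : Subset v → ℕ  (m B = number of copies of block B).
pairCount : {v : ℕ} → (Subset v → ℕ) → Fin v → Fin v → ℕ
pairCount {v} m x y =
  sum (map (λ B → if ⌊ x ∈? B ⌋ ∧ ⌊ y ∈? B ⌋ then m B else 0) (allSubsets v))

IsDesign : (v k λ′ : ℕ) → (Subset v → ℕ) → Set
IsDesign v k λ′ m =
  (∀ (B : Subset v) → 0 < m B → ∣ B ∣ ≡ k) ×
  (∀ (x y : Fin v) → x ≢ y → pairCount m x y ≡ λ′)

isK : {v : ℕ} → ℕ → Subset v → Bool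
isK k B = ⌊ ∣ B ∣ Data.Nat.≟ k ⌋

Full : (v k : ℕ) → Subset v → ℕ
Full v k B = if isK k B then 1 else 0

IsSubsetOfFull : (v k : ℕ) → (Subset v → Bool) → Set
IsSubsetOfFull v k D = ∀ (B : Subset v) → D B ≡ true → ∣ B ∣ ≡ k

Contains : {v : ℕ} → (Subset v → Bool) → (Subset v → ℕ) → Set
Contains D m = ∀ B → D B ≡ true → 1 ≤ m B

IsDefiningSet : (v k : ℕ) → (Subset v → Bool) → Set
IsDefiningSet v k D =
  ∀ (m : Subset v → ℕ) → IsDesign v k ((v ∸ 2) C (k ∸ 2)) m → Contains D m →
  ∀ (B : Subset v) → m B ≡ Full v k B

triple : {v : ℕ} → Fin v → Fin v → Fin v → Subset v
triple i j c = ⁅ i ⁆ ∪ (⁅ j ⁆ ∪ ⁅ c ⁆)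

-- s_{a,b}(D): number of unordered pairs {i,j} ⊆ N(v) ∖ {a,b} (i ≠ j) such that
-- neither {i,j,a} nor {i,j,b} belongs to D.  Unordered pairs are enumerated as
-- ordered pairs with toℕ i < toℕ j.
sCount : {v : ℕ} → (Subset v → Bool) → Fin v → Fin v → ℕ
sCount {v} D a b =
  length (filter (λ p → goodPair p) pairs)
  where
    pairs : List (Fin v × Fin v)
    pairs = concatMap (λ i → map (λ j → (i , j)) (allFin v)) (allFin v)
    ok : Fin v × Fin v → Bool
    ok (i , j) =
      ⌊ toℕ i <? toℕ j ⌋
      ∧ not ⌊ i ≟ a ⌋ ∧ not ⌊ i ≟ b ⌋ ∧ not ⌊ j ≟ a ⌋ ∧ not ⌊ j ≟ b ⌋
      ∧ not (D (triple i j a)) ∧ not (D (triple i j b))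
    goodPair : (p : Fin v × Fin v) → Dec (ok p ≡ true)
    goodPair p = ok p Data.Bool.≟ true

-- Let G be the graph on N(v) ∖ {a,b} in which ij is an edge when neither
-- {i,j,a} nor {i,j,b} lies in D; by definition G has s_{a,b}(D) edges.
--
-- If G has an even closed trail w₀ w₁ … w_{2k} = w₀ (a closed walk
--     of even length with pairwise distinct edges), replace the blocks
--     {w₀,w₁,a}, {w₁,w₂,b}, {w₂,w₃,a}, … of F(v,3) by {w₀,w₁,b}, {w₁,w₂,a}, ….
--     Every point is entered and left equally often along even and odd edges,
--     so pair counts are preserved; no block of D is removed.  This gives a
--     second design containing D, so D is not a defining set.
-- (2) Extremal bound.  A graph on n ≥ 1 vertices without even closed trails
--     has 3e + 3 ≤ 4n.  By induction on n: delete a vertex of degree ≤ 1, or the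
--     end p₀ of a maximal path; a third neighbour of p₀ yields a theta graph
--     (hence an even cycle), so p₀ has degree two and lies on a cycle K.  The
--     induction carries a set of "hot" vertices, through which every cycle
--     yields an even closed trail: the two neighbours of p₀ become hot, since a
--     further cycle through them shares a vertex with K.
-- (3) With n = v - 2, (2) contradicts s_{a,b}(D) > ⌊(4v-11)/3⌋, so (1) applies.

module Submission where

open import Defs
open import Data.Nat
  using (ℕ; zero; suc; _+_; _*_; _∸_; _/_; _≤_; _<_; _≤?_; _<?_; _≡ᵇ_; _≤ᵇ_; _<ᵇ_; s≤s; z≤n)
open import Data.Nat.Properties
  using (+-identityʳ; +-comm; +-suc; *-comm; *-zeroʳ; *-distribʳ-+; *-distribˡ-+;
         ≤-refl; ≤-reflexive; ≤-trans; ≤-pred; m≤n+m; m≤m+n; n≤1+n; <⇒≱; ≰⇒>;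
         +-mono-≤; +-monoˡ-≤; +-monoʳ-≤; +-mono-≤-<; *-monoʳ-≤; +-cancelʳ-≡; +-cancelʳ-≤;
         ≡ᵇ⇒≡; m∸n+n≡m; m+n∸m≡n; 0∸n≡0; suc-injective; module ≤-Reasoning)
open import Data.Nat.Combinatorics using (_C_; nCk+nC[k+1]≡[n+1]C[k+1])
open import Data.Nat.DivMod using (m*n/n≡m; /-monoˡ-≤)
open import Data.Nat.ListAction using (sum)
open import Data.Nat.ListAction.Properties using (sum-++)
open import Data.Nat.Tactic.RingSolver using (solve-∀)
open import Data.Bool using (Bool; true; false; if_then_else_; _∧_; _∨_; not; T)
import Data.Bool as Bool
open import Data.Bool.Properties using (∧-zeroʳ; ∧-identityʳ; ∨-zeroʳ; ∨-assoc)
open import Data.Fin using (Fin; zero; suc; toℕ)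
import Data.Fin as F
open import Data.Fin.Subset using (Subset; inside; outside; ⁅_⁆; _∪_; ∣_∣)
open import Data.Fin.Subset.Properties using (_∈?_; ∣⁅x⁆∣≡1; ∪-identityˡ; ∪-assoc; ∪-comm)
open import Data.Vec using ([]; _∷_; lookup)
open import Data.Vec.Properties using (lookup-zipWith; lookup-replicate)
open import Data.List
  using (List; []; _∷_; map; _++_; [_]; length; reverse; filter; concatMap; allFin)
open import Data.List.Membership.Propositional using (_∈_; _∉_; find; lose)
open import Data.List.Membership.Propositional.Properties
  using (∈-++⁺ˡ; ∈-++⁺ʳ; ∈-++⁻; ∈-∃++; ∈-allFin)
open import Data.List.Relation.Unary.Any using (here; there; any?)
open import Data.List.Relation.Unary.Any.Properties using (reverse⁻)
open import Data.List.Relation.Unary.All using (All; []; _∷_)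
import Data.List.Relation.Unary.All as All
open import Data.List.Relation.Unary.AllPairs using (AllPairs; []; _∷_)
import Data.List.Relation.Unary.AllPairs.Properties as AllPairs
open import Data.List.Properties
  using (map-cong; map-++; map-∘; ++-assoc; length-++; length-++-sucʳ; length-++-comm;
         unfold-reverse; reverse-++; length-reverse; map-tabulate; length-tabulate)
open import Data.Product using (Σ-syntax; _×_; _,_; proj₁; proj₂)
open import Data.Sum using (_⊎_; inj₁; inj₂; [_,_]′; map₂)
open import Data.Unit using (⊤; tt)
open import Data.Empty using (⊥; ⊥-elim)
open import Function using (_∘_)
open import Relation.Nullary using (¬_; Dec; yes; no; ¬?)
open import Relation.Unary using (Decidable)
open import Relation.Binary.Definitions using (DecidableEquality)
open import Relation.Nullary.Decidable using (⌊_⌋; ⌊⌋-map′; T?; _×-dec_)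
open import Relation.Binary.PropositionalEquality
  using (_≡_; _≢_; refl; sym; trans; cong; cong₂; subst; subst₂; module ≡-Reasoning)

bit : Bool → ℕ
bit true  = 1
bit false = 0

true≢false : true ≢ false
true≢false ()

∧-true : ∀ {p q} → (p ∧ q) ≡ true → p ≡ true × q ≡ true
∧-true {true} {true} _ = refl , refl

not-true : ∀ {p} → not p ≡ true → p ≡ false
not-true {false} _ = refl

not-false : ∀ {p} → not p ≡ false → p ≡ true
not-false {true} _ = refl

bit-mono : ∀ {p q} → (p ≡ true → q ≡ true) → bit p ≤ bit q
bit-mono {true}  p⇒q rewrite p⇒q refl = s≤s z≤n
bit-mono {false} p⇒q = z≤n

⌊T?⌋ : ∀ b → ⌊ T? b ⌋ ≡ b
⌊T?⌋ true  = refl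
⌊T?⌋ false = refl

⌊<?⌋ : ∀ m n → ⌊ m <? n ⌋ ≡ (m <ᵇ n)
⌊<?⌋ m n = trans (⌊⌋-map′ _ _ (T? (suc m ≤ᵇ n))) (⌊T?⌋ (suc m ≤ᵇ n))

_==_ : ∀ {n} → Fin n → Fin n → Bool
i == j = ⌊ i F.≟ j ⌋

==-refl : ∀ {n} (i : Fin n) → (i == i) ≡ true
==-refl i with i F.≟ i
... | yes _ = refl
... | no i≢i = ⊥-elim (i≢i refl)

==-≢ : ∀ {n} {i j : Fin n} → i ≢ j → (i == j) ≡ false
==-≢ {i = i} {j} i≢j with i F.≟ j
... | yes i≡j = ⊥-elim (i≢j i≡j)
... | no _ = refl

==-sound : ∀ {n} {i j : Fin n} → (i == j) ≡ true → i ≡ j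
==-sound {i = i} {j} e with i F.≟ j
... | yes i≡j = i≡j

==-sym : ∀ {n} (i j : Fin n) → (i == j) ≡ (j == i)
==-sym i j with i F.≟ j | j F.≟ i
... | yes _   | yes _ = refl
... | no _    | no _  = refl
... | yes i≡j | no j≢i = ⊥-elim (j≢i (sym i≡j))
... | no i≢j  | yes j≡i = ⊥-elim (i≢j (sym j≡i))

lookup-∈? : ∀ {n} (i : Fin n) p → ⌊ i ∈? p ⌋ ≡ lookup p i
lookup-∈? zero    (inside ∷ p)  = refl
lookup-∈? zero    (outside ∷ p) = refl
lookup-∈? (suc i) (_ ∷ p)       = trans (⌊⌋-map′ _ _ (i ∈? p)) (lookup-∈? i p)

lookup-⁅⁆ : ∀ {n} (i j : Fin n) → lookup ⁅ j ⁆ i ≡ (i == j)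
lookup-⁅⁆ zero    zero    = refl
lookup-⁅⁆ zero    (suc j) = refl
lookup-⁅⁆ (suc i) zero    = lookup-replicate i outside
lookup-⁅⁆ (suc i) (suc j) = trans (lookup-⁅⁆ i j) (sym (⌊⌋-map′ _ _ (i F.≟ j)))

lookup-triple : ∀ {n} (i u w c : Fin n) →
  lookup (triple u w c) i ≡ ((i == u) ∨ ((i == w) ∨ (i == c)))
lookup-triple i u w c
  rewrite lookup-zipWith _∨_ i ⁅ u ⁆ (⁅ w ⁆ ∪ ⁅ c ⁆) | lookup-zipWith _∨_ i ⁅ w ⁆ ⁅ c ⁆
        | lookup-⁅⁆ i u | lookup-⁅⁆ i w | lookup-⁅⁆ i c = refl

∣⁅u⁆∪p∣ : ∀ {n} (u : Fin n) p → lookup p u ≡ false → ∣ ⁅ u ⁆ ∪ p ∣ ≡ suc ∣ p ∣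
∣⁅u⁆∪p∣ zero    (false ∷ p) _ = cong (suc ∘ ∣_∣) (∪-identityˡ p)
∣⁅u⁆∪p∣ (suc u) (true ∷ p)  e = cong suc (∣⁅u⁆∪p∣ u p e)
∣⁅u⁆∪p∣ (suc u) (false ∷ p) e = ∣⁅u⁆∪p∣ u p e

∣triple∣ : ∀ {n} (u w c : Fin n) → u ≢ w → u ≢ c → w ≢ c → ∣ triple u w c ∣ ≡ 3
∣triple∣ u w c u≢w u≢c w≢c =
  trans (∣⁅u⁆∪p∣ u (⁅ w ⁆ ∪ ⁅ c ⁆) u∉)
        (cong suc (trans (∣⁅u⁆∪p∣ w ⁅ c ⁆ w∉) (cong suc (∣⁅x⁆∣≡1 c))))
  where
  u∉ : lookup (⁅ w ⁆ ∪ ⁅ c ⁆) u ≡ false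
  u∉ rewrite lookup-zipWith _∨_ u ⁅ w ⁆ ⁅ c ⁆ | lookup-⁅⁆ u w | lookup-⁅⁆ u c
           | ==-≢ u≢w | ==-≢ u≢c = refl
  w∉ : lookup ⁅ c ⁆ w ≡ false
  w∉ = trans (lookup-⁅⁆ w c) (==-≢ w≢c)

triple-swap : ∀ {n} (i j c : Fin n) → triple i j c ≡ triple j i c
triple-swap i j c = swap ⁅ i ⁆ ⁅ j ⁆ ⁅ c ⁆
  where
  swap : ∀ {n} (p q r : Subset n) → p ∪ (q ∪ r) ≡ q ∪ (p ∪ r)
  swap p q r = trans (sym (∪-assoc p q r))
    (trans (cong (_∪ r) (∪-comm p q)) (∪-assoc q p r))

sum-map-+ : ∀ {A : Set} (f g : A → ℕ) xs →
  sum (map (λ x → f x + g x) xs) ≡ sum (map f xs) + sum (map g xs)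
sum-map-+ f g []       = refl
sum-map-+ f g (x ∷ xs) rewrite sum-map-+ f g xs =
  interchange (f x) (g x) (sum (map f xs)) (sum (map g xs))
  where
  interchange : ∀ p q r s → p + q + (r + s) ≡ p + r + (q + s)
  interchange = solve-∀

sum-map-0 : ∀ {A : Set} (f : A → ℕ) xs → (∀ {x} → x ∈ xs → f x ≡ 0) → sum (map f xs) ≡ 0
sum-map-0 f []       z = refl
sum-map-0 f (x ∷ xs) z rewrite z (here refl) = sum-map-0 f xs (z ∘ there)

sumS : ∀ n → (Subset n → ℕ) → ℕ
sumS n h = sum (map h (allSubsets n))

sumS-cong : ∀ n {h h′ : Subset n → ℕ} → (∀ B → h B ≡ h′ B) → sumS n h ≡ sumS n h′
sumS-cong n e = cong sum (map-cong e (allSubsets n))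

sumS-0 : ∀ n (h : Subset n → ℕ) → (∀ B → h B ≡ 0) → sumS n h ≡ 0
sumS-0 n h z = sum-map-0 h (allSubsets n) (λ {B} _ → z B)

sumS-suc : ∀ n (h : Subset (suc n) → ℕ) →
  sumS (suc n) h ≡ sumS n (λ B → h (outside ∷ B)) + sumS n (λ B → h (inside ∷ B))
sumS-suc n h = begin
  sum (map h (map (outside ∷_) S ++ map (inside ∷_) S))
    ≡⟨ cong sum (map-++ h (map (outside ∷_) S) _) ⟩
  sum (map h (map (outside ∷_) S) ++ map h (map (inside ∷_) S))
    ≡⟨ sum-++ (map h (map (outside ∷_) S)) _ ⟩
  sum (map h (map (outside ∷_) S)) + sum (map h (map (inside ∷_) S))
    ≡⟨ sym (cong₂ _+_ (cong sum (map-∘ S)) (cong sum (map-∘ S))) ⟩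
  sumS n (λ B → h (outside ∷ B)) + sumS n (λ B → h (inside ∷ B)) ∎
  where
  open ≡-Reasoning
  S = allSubsets n

_=ˢ_ : ∀ {n} → Subset n → Subset n → Bool
[]      =ˢ []      = true
(x ∷ p) =ˢ (y ∷ q) = (x ≡ᵇᵒ y) ∧ (p =ˢ q)
  where
  _≡ᵇᵒ_ : Bool → Bool → Bool
  true  ≡ᵇᵒ y = y
  false ≡ᵇᵒ y = not y

=ˢ-sound : ∀ {n} (p q : Subset n) → (p =ˢ q) ≡ true → p ≡ q
=ˢ-sound []          []          _ = refl
=ˢ-sound (true ∷ p)  (true ∷ q)  e = cong (true ∷_)  (=ˢ-sound p q e)
=ˢ-sound (false ∷ p) (false ∷ q) e = cong (false ∷_) (=ˢ-sound p q e)

=ˢ-refl : ∀ {n} (p : Subset n) → (p =ˢ p) ≡ true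
=ˢ-refl []          = refl
=ˢ-refl (true ∷ p)  = =ˢ-refl p
=ˢ-refl (false ∷ p) = =ˢ-refl p

=ˢ-false : ∀ {n} (p q : Subset n) → p ≢ q → (p =ˢ q) ≡ false
=ˢ-false p q p≢q with p =ˢ q in e
... | true  = ⊥-elim (p≢q (=ˢ-sound p q e))
... | false = refl

single : ∀ {n} → Subset n → Subset n → ℕ
single T B = bit (B =ˢ T)

sumS-at : ∀ n (T : Subset n) (f : Subset n → ℕ) →
  sumS n (λ B → if B =ˢ T then f B else 0) ≡ f T
sumS-at zero    []          f = +-identityʳ (f [])
sumS-at (suc n) (true ∷ T)  f = trans (sumS-suc n _)
  (cong₂ _+_ (sumS-0 n _ (λ _ → refl)) (sumS-at n T (λ B → f (true ∷ B))))
sumS-at (suc n) (false ∷ T) f = trans (sumS-suc n _)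
  (trans (cong₂ _+_ (sumS-at n T (λ B → f (false ∷ B))) (sumS-0 n _ (λ _ → refl)))
         (+-identityʳ _))

if-0 : ∀ {A : Set} (b : Bool) (x : A) → (if b then x else x) ≡ x
if-0 true  x = refl
if-0 false x = refl

pairCount-+ : ∀ {v} (m₁ m₂ : Subset v → ℕ) x y →
  pairCount (λ B → m₁ B + m₂ B) x y ≡ pairCount m₁ x y + pairCount m₂ x y
pairCount-+ {v} m₁ m₂ x y = trans (sumS-cong v split) (sum-map-+ _ _ (allSubsets v))
  where
  split : ∀ B → (if ⌊ x ∈? B ⌋ ∧ ⌊ y ∈? B ⌋ then m₁ B + m₂ B else 0)
              ≡ (if ⌊ x ∈? B ⌋ ∧ ⌊ y ∈? B ⌋ then m₁ B else 0)
                + (if ⌊ x ∈? B ⌋ ∧ ⌊ y ∈? B ⌋ then m₂ B else 0)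
  split B with ⌊ x ∈? B ⌋ ∧ ⌊ y ∈? B ⌋
  ... | true  = refl
  ... | false = refl

pairCount-cong : ∀ {v} (m₁ m₂ : Subset v → ℕ) x y → (∀ B → m₁ B ≡ m₂ B) →
  pairCount m₁ x y ≡ pairCount m₂ x y
pairCount-cong {v} m₁ m₂ x y e =
  sumS-cong v (λ B → cong (if ⌊ x ∈? B ⌋ ∧ ⌊ y ∈? B ⌋ then_else 0) (e B))

pairCount-0 : ∀ {v} (m : Subset v → ℕ) x y → (∀ B → m B ≡ 0) → pairCount m x y ≡ 0
pairCount-0 {v} m x y z =
  sumS-0 v _ (λ B → trans (cong (if ⌊ x ∈? B ⌋ ∧ ⌊ y ∈? B ⌋ then_else 0) (z B)) (if-0 _ 0))

pairCount-single : ∀ {v} (T : Subset v) x y →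
  pairCount (single T) x y ≡ bit (lookup T x ∧ lookup T y)
pairCount-single {v} T x y =
  trans (sumS-cong v swap)
   (trans (sumS-at v T (λ B → bit (⌊ x ∈? B ⌋ ∧ ⌊ y ∈? B ⌋)))
          (cong₂ (λ p q → bit (p ∧ q)) (lookup-∈? x T) (lookup-∈? y T)))
  where
  swap : ∀ B → (if ⌊ x ∈? B ⌋ ∧ ⌊ y ∈? B ⌋ then single T B else 0)
             ≡ (if B =ˢ T then bit (⌊ x ∈? B ⌋ ∧ ⌊ y ∈? B ⌋) else 0)
  swap B with ⌊ x ∈? B ⌋ ∧ ⌊ y ∈? B ⌋ | B =ˢ T
  ... | true  | true  = refl
  ... | true  | false = refl
  ... | false | true  = refl
  ... | false | false = refl

-- The full design F(v,3) is a (v,3,v-2)-design.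

-- Indicator of the k-subsets, with a size test that computes on cons-cells.
ofSize : ∀ {n} → ℕ → Subset n → ℕ
ofSize k B = if ∣ B ∣ ≡ᵇ k then 1 else 0

Full≗ofSize : ∀ v k (B : Subset v) → Full v k B ≡ ofSize k B
Full≗ofSize v k B =
  cong (if_then 1 else 0) (trans (⌊⌋-map′ _ _ (T? (∣ B ∣ ≡ᵇ k))) (⌊T?⌋ (∣ B ∣ ≡ᵇ k)))

Full-k : ∀ {v k} (B : Subset v) → ∣ B ∣ ≡ k → Full v k B ≡ 1
Full-k {v} {k} B e =
  trans (Full≗ofSize v k B) (cong (if_then 1 else 0) (trans (cong (_≡ᵇ k) e) (≡ᵇ-refl k)))
  where
  ≡ᵇ-refl : ∀ n → (n ≡ᵇ n) ≡ true
  ≡ᵇ-refl zero    = refl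
  ≡ᵇ-refl (suc n) = ≡ᵇ-refl n

Full-size : ∀ {v k} (B : Subset v) → 1 ≤ Full v k B → ∣ B ∣ ≡ k
Full-size {v} {k} B h rewrite Full≗ofSize v k B with ∣ B ∣ ≡ᵇ k in e
... | true  = ≡ᵇ⇒≡ ∣ B ∣ k (subst T (sym e) tt)
... | false with h
...   | ()

-- throughC n j s = C(n, s - j), the number of s-subsets of an (n+j)-set that
-- contain j prescribed points (0 when s < j).
throughC : ℕ → ℕ → ℕ → ℕ
throughC n zero    s       = n C s
throughC n (suc j) zero    = 0
throughC n (suc j) (suc s) = throughC n j s

pascal : ∀ n j s → throughC n j s + throughC n (suc j) s ≡ throughC (suc n) j s
pascal n zero    zero    = refl
pascal n zero    (suc s) = trans (+-comm (n C suc s) (n C s)) (nCk+nC[k+1]≡[n+1]C[k+1] n s)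
pascal n (suc j) zero    = refl
pascal n (suc j) (suc s) = pascal n j s

count₀ : ∀ n s → sumS n (ofSize s) ≡ n C s
count₀ zero    zero    = refl
count₀ zero    (suc s) = refl
count₀ (suc n) zero    = trans (sumS-suc n (ofSize 0))
  (cong₂ _+_ (count₀ n 0) (sumS-0 n _ (λ _ → refl)))
count₀ (suc n) (suc s) = trans (sumS-suc n (ofSize (suc s)))
  (trans (cong₂ _+_ (count₀ n (suc s)) (count₀ n s)) (pascal n 0 (suc s)))

count₁ : ∀ n (x : Fin (suc n)) s →
  sumS (suc n) (λ B → if lookup B x then ofSize s B else 0) ≡ throughC n 1 s
count₁ n zero zero = trans (sumS-suc n _)
  (cong₂ _+_ (sumS-0 n _ (λ _ → refl)) (sumS-0 n _ (λ _ → refl)))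
count₁ n zero (suc s) = trans (sumS-suc n _)
  (cong₂ _+_ (sumS-0 n _ (λ _ → refl)) (count₀ n s))
count₁ (suc n) (suc x) zero = trans (sumS-suc (suc n) _)
  (cong₂ _+_ (count₁ n x zero) (sumS-0 (suc n) _ (λ B → if-0 (lookup B x) 0)))
count₁ (suc n) (suc x) (suc s) = trans (sumS-suc (suc n) _)
  (trans (cong₂ _+_ (count₁ n x (suc s)) (count₁ n x s)) (pascal n 1 (suc s)))

count₂ : ∀ n (x y : Fin (suc (suc n))) → x ≢ y → ∀ s →
  sumS (suc (suc n)) (λ B → if lookup B x ∧ lookup B y then ofSize s B else 0)
    ≡ throughC n 2 s
count₂ n zero zero x≢y s = ⊥-elim (x≢y refl)
count₂ n zero (suc y) _ zero = trans (sumS-suc (suc n) _)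
  (cong₂ _+_ (sumS-0 (suc n) _ (λ _ → refl)) (sumS-0 (suc n) _ (λ B → if-0 (lookup B y) 0)))
count₂ n zero (suc y) _ (suc s) = trans (sumS-suc (suc n) _)
  (cong₂ _+_ (sumS-0 (suc n) _ (λ _ → refl)) (count₁ n y s))
count₂ n (suc x) zero _ s = trans (sumS-suc (suc n) _)
  (cong₂ _+_ (sumS-0 (suc n) _ (λ B → cong (if_then _ else 0) (∧-zeroʳ (lookup B x))))
             (trans (sumS-cong (suc n) (λ B → cong (if_then _ else 0) (∧-identityʳ (lookup B x))))
                    (inside-part s)))
  where
  inside-part : ∀ s → sumS (suc n) (λ B → if lookup B x then ofSize s (inside ∷ B) else 0)
                        ≡ throughC n 2 s
  inside-part zero    = sumS-0 (suc n) _ (λ B → if-0 (lookup B x) 0)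
  inside-part (suc s) = count₁ n x s
count₂ zero (suc zero) (suc zero) x≢y s = ⊥-elim (x≢y refl)
count₂ (suc n) (suc x) (suc y) x≢y zero = trans (sumS-suc (suc (suc n)) _)
  (cong₂ _+_ (count₂ n x y (x≢y ∘ cong suc) zero)
             (sumS-0 (suc (suc n)) _ (λ B → if-0 (lookup B x ∧ lookup B y) 0)))
count₂ (suc n) (suc x) (suc y) x≢y (suc s) = trans (sumS-suc (suc (suc n)) _)
  (trans (cong₂ _+_ (count₂ n x y (x≢y ∘ cong suc) (suc s)) (count₂ n x y (x≢y ∘ cong suc) s))
         (pascal n 2 (suc s)))

pairCount-Full : ∀ v (x y : Fin v) → x ≢ y → pairCount (Full v 3) x y ≡ (v ∸ 2) C (3 ∸ 2)
pairCount-Full (suc (suc n)) x y x≢y =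
  trans (sumS-cong (suc (suc n)) by-lookup) (count₂ n x y x≢y 3)
  where
  by-lookup : ∀ B → (if ⌊ x ∈? B ⌋ ∧ ⌊ y ∈? B ⌋ then Full (suc (suc n)) 3 B else 0)
                  ≡ (if lookup B x ∧ lookup B y then ofSize 3 B else 0)
  by-lookup B rewrite lookup-∈? x B | lookup-∈? y B | Full≗ofSize (suc (suc n)) 3 B = refl
pairCount-Full (suc zero) zero zero x≢y = ⊥-elim (x≢y refl)

-- Graphs without even closed trails have few edges.  The graph is a simple
-- graph on a type V with decidable equality, given by a symmetric, irreflexive
-- Boolean adjacency relation.
module EvenTrails {V : Set} (_≟_ : DecidableEquality V) (E : V → V → Bool)
  (E-sym : ∀ x y → E x y ≡ E y x) (E-irr : ∀ x → E x x ≡ false) where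

  open import Data.List.Membership.DecPropositional _≟_ using () renaming (_∈?_ to _∈ᴸ?_)

  Adj : V → V → Set
  Adj x y = E x y ≡ true

  adj-sym : ∀ {x y} → Adj x y → Adj y x
  adj-sym {x} {y} a = trans (E-sym y x) a

  adj-irr : ∀ {x y} → Adj x y → x ≢ y
  adj-irr {x} a refl with trans (sym a) (E-irr x)
  ... | ()

  data Uniq : List V → Set where
    []  : Uniq []
    _∷_ : ∀ {x xs} → x ∉ xs → Uniq xs → Uniq (x ∷ xs)

  Disj : List V → List V → Set
  Disj A B = ∀ {z} → z ∈ A → z ∈ B → ⊥

  uhead : ∀ {x xs} → Uniq (x ∷ xs) → x ∉ xs
  uhead (x∉ ∷ _) = x∉

  utail : ∀ {x xs} → Uniq (x ∷ xs) → Uniq xs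
  utail (_ ∷ u) = u

  uniq-++⁺ : ∀ {A B} → Uniq A → Uniq B → Disj A B → Uniq (A ++ B)
  uniq-++⁺ [] uB d = uB
  uniq-++⁺ {x ∷ A} (x∉ ∷ uA) uB d =
    (λ p → [ x∉ , d (here refl) ]′ (∈-++⁻ A p)) ∷ uniq-++⁺ uA uB (d ∘ there)

  uniq-++⁻ : ∀ A {B} → Uniq (A ++ B) → Uniq A × Uniq B × Disj A B
  uniq-++⁻ []      u = [] , u , λ ()
  uniq-++⁻ (x ∷ A) (x∉ ∷ u) with uniq-++⁻ A u
  ... | uA , uB , d = (x∉ ∘ ∈-++⁺ˡ) ∷ uA , uB , d′
    where
    d′ : Disj (x ∷ A) _
    d′ (here refl) q = x∉ (∈-++⁺ʳ A q)
    d′ (there p)   q = d p q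

  uniq-rot : ∀ A B → Uniq (A ++ B) → Uniq (B ++ A)
  uniq-rot A B u with uniq-++⁻ A u
  ... | uA , uB , d = uniq-++⁺ uB uA (λ p q → d q p)

  uniq-rev : ∀ {A} → Uniq A → Uniq (reverse A)
  uniq-rev [] = []
  uniq-rev {x ∷ A} (x∉ ∷ u) = subst Uniq (sym (unfold-reverse x A))
    (uniq-++⁺ (uniq-rev u) ((λ ()) ∷ []) λ { p (here refl) → x∉ (reverse⁻ p) })

  uniq-prefix : ∀ A (b : V) B → Uniq (A ++ b ∷ B) → Uniq (A ++ [ b ])
  uniq-prefix A b B u = proj₁ (uniq-++⁻ (A ++ [ b ]) (subst Uniq (sym (++-assoc A [ b ] B)) u))

  ∈-prefix : ∀ (A : List V) {b B y} → y ∈ A ++ [ b ] → y ∈ A ++ b ∷ B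
  ∈-prefix A {b} {B} {y} q = subst (y ∈_) (++-assoc A [ b ] B) (∈-++⁺ˡ q)

  Path : List V → Set
  Path []            = ⊤
  Path (x ∷ [])      = ⊤
  Path (x ∷ y ∷ r)   = Adj x y × Path (y ∷ r)

  path-++ʳ : ∀ A b B → Path (A ++ b ∷ B) → Path (b ∷ B)
  path-++ʳ []          b B p = p
  path-++ʳ (x ∷ [])    b B p = proj₂ p
  path-++ʳ (x ∷ y ∷ A) b B p = path-++ʳ (y ∷ A) b B (proj₂ p)

  path-++ˡ : ∀ A b B → Path (A ++ b ∷ B) → Path (A ++ [ b ])
  path-++ˡ []          b B p = tt
  path-++ˡ (x ∷ [])    b B p = proj₁ p , tt
  path-++ˡ (x ∷ y ∷ A) b B p = proj₁ p , path-++ˡ (y ∷ A) b B (proj₂ p)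

  path-glue : ∀ A b B → Path (A ++ [ b ]) → Path (b ∷ B) → Path (A ++ b ∷ B)
  path-glue []          b B p q = q
  path-glue (x ∷ [])    b B p q = proj₁ p , q
  path-glue (x ∷ y ∷ A) b B p q = proj₁ p , path-glue (y ∷ A) b B (proj₂ p) q

  path-rev : ∀ L → Path L → Path (reverse L)
  path-rev []          p = tt
  path-rev (x ∷ [])    p = tt
  path-rev (x ∷ y ∷ r) (a , p) = subst Path (sym eq)
    (path-glue (reverse r) y [ x ] (subst Path (unfold-reverse y r) (path-rev (y ∷ r) p)) (adj-sym a , tt))
    where
    eq : reverse (x ∷ y ∷ r) ≡ reverse r ++ y ∷ [ x ]
    eq = trans (unfold-reverse x (y ∷ r))
      (trans (cong (_++ [ x ]) (unfold-reverse y r)) (++-assoc (reverse r) [ y ] [ x ]))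

  edges : List V → List (V × V)
  edges []          = []
  edges (x ∷ [])    = []
  edges (x ∷ y ∷ r) = (x , y) ∷ edges (y ∷ r)

  Same : V × V → V × V → Set
  Same (x , y) (u , w) = (x ≡ u × y ≡ w) ⊎ (x ≡ w × y ≡ u)

  NotSame : V × V → V × V → Set
  NotSame e f = ¬ Same e f

  edges-++ : ∀ A b B → edges (A ++ b ∷ B) ≡ edges (A ++ [ b ]) ++ edges (b ∷ B)
  edges-++ []          b B = refl
  edges-++ (x ∷ [])    b B = refl
  edges-++ (x ∷ y ∷ A) b B = cong ((x , y) ∷_) (edges-++ (y ∷ A) b B)

  edge-fst : ∀ {u w} L → (u , w) ∈ edges L → u ∈ L
  edge-fst (x ∷ y ∷ r) (here refl) = here refl
  edge-fst (x ∷ y ∷ r) (there p)   = there (edge-fst (y ∷ r) p)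

  edge-snd : ∀ {u w} x L → (u , w) ∈ edges (x ∷ L) → w ∈ L
  edge-snd x (y ∷ r) (here refl) = here refl
  edge-snd x (y ∷ r) (there p)   = there (edge-snd y r p)

  edge-adj : ∀ {u w} L → Path L → (u , w) ∈ edges L → Adj u w
  edge-adj (x ∷ y ∷ r) (a , p) (here refl) = a
  edge-adj (x ∷ y ∷ r) (a , p) (there q)   = edge-adj (y ∷ r) p q

  uniq-edges : ∀ L → Uniq L → AllPairs NotSame (edges L)
  uniq-edges []          u = []
  uniq-edges (x ∷ [])    u = []
  uniq-edges (x ∷ y ∷ r) (x∉ ∷ u) = All.tabulate new ∷ uniq-edges (y ∷ r) u
    where
    new : ∀ {f} → f ∈ edges (y ∷ r) → NotSame (x , y) f
    new p (inj₁ (refl , _)) = x∉ (edge-fst (y ∷ r) p)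
    new p (inj₂ (refl , _)) = x∉ (there (edge-snd y r p))

  even? : ℕ → Bool
  even? zero    = true
  even? (suc n) = not (even? n)

  even?-+ : ∀ m n → even? (m + n) ≡ (if even? m then even? n else not (even? n))
  even?-+ zero    n = refl
  even?-+ (suc m) n rewrite even?-+ m n with even? m | even? n
  ... | true  | true  = refl
  ... | true  | false = refl
  ... | false | true  = refl
  ... | false | false = refl

  -- A cycle c R: the closed walk c ∷ R ++ [ c ] through at least three
  -- distinct vertices; its length is suc (length R).
  record Cycle (c : V) (R : List V) : Set where
    constructor mkCycle
    field
      cycle-uniq : Uniq (c ∷ R)
      cycle-long : 2 ≤ length R
      cycle-path : Path (c ∷ R ++ [ c ])
  open Cycle public

  -- An even closed trail: a closed walk of even length with distinct edges.
  -- This is exactly what is needed to build a trade (see module TradeGraph).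
  record EvenTrail : Set where
    constructor mkEvenTrail
    field
      start : V
      route : List V
      trail-path     : Path (start ∷ route ++ [ start ])
      trail-distinct : AllPairs NotSame (edges (start ∷ route ++ [ start ]))
      trail-even     : even? (suc (length route)) ≡ true
  open EvenTrail public

  cycle-distinct : ∀ {c R} → Cycle c R → AllPairs NotSame (edges (c ∷ R ++ [ c ]))
  cycle-distinct {c} {r₁ ∷ r₂ ∷ R} (mkCycle u _ _) =
    All.tabulate new ∷ uniq-edges (r₁ ∷ r₂ ∷ R ++ [ c ]) u′
    where
    u′ : Uniq (r₁ ∷ r₂ ∷ R ++ [ c ])
    u′ = uniq-rot [ c ] (r₁ ∷ r₂ ∷ R) u
    new : ∀ {f} → f ∈ edges (r₁ ∷ r₂ ∷ R ++ [ c ]) → NotSame (c , r₁) f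
    new q (inj₁ (refl , refl)) = uhead u′ (edge-snd r₁ (r₂ ∷ R ++ [ c ]) q)
    new (here refl) (inj₂ (refl , refl)) = uhead u (there (here refl))
    new (there q)   (inj₂ (refl , refl)) = uhead u′ (edge-fst (r₂ ∷ R ++ [ c ]) q)
  cycle-distinct {R = []}     (mkCycle _ () _)
  cycle-distinct {R = _ ∷ []} (mkCycle _ (s≤s ()) _)

  even-cycle : ∀ {c R} → Cycle c R → even? (suc (length R)) ≡ true → EvenTrail
  even-cycle {c} {R} cyc e = mkEvenTrail c R (cycle-path cyc) (cycle-distinct cyc) e

  ∈-snoc : ∀ {z x : V} A → z ∈ A ++ [ x ] → z ∈ x ∷ A
  ∈-snoc A p with ∈-++⁻ A p
  ... | inj₁ q = there q
  ... | inj₂ (here refl) = here refl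

  bowtie : ∀ {x R₁ R₂} → Cycle x R₁ → Cycle x R₂ → Disj R₁ (x ∷ R₂) →
    even? (suc (length R₁)) ≡ false → even? (suc (length R₂)) ≡ false → EvenTrail
  bowtie {x} {R₁} {R₂} cyc₁ cyc₂ disjoint odd₁ odd₂ = mkEvenTrail x (R₁ ++ x ∷ R₂) walk distinct even
    where
    reassoc : x ∷ (R₁ ++ x ∷ R₂) ++ [ x ] ≡ (x ∷ R₁) ++ x ∷ (R₂ ++ [ x ])
    reassoc = cong (x ∷_) (++-assoc R₁ (x ∷ R₂) [ x ])
    walk : Path (x ∷ (R₁ ++ x ∷ R₂) ++ [ x ])
    walk = subst Path (sym reassoc)
      (path-glue (x ∷ R₁) x (R₂ ++ [ x ]) (cycle-path cyc₁) (cycle-path cyc₂))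
    only-x : ∀ {z} → z ∈ x ∷ R₁ → z ∈ x ∷ R₂ → z ≡ x
    only-x (here refl) q = refl
    only-x (there p)   q = ⊥-elim (disjoint p q)
    fst∈ : ∀ {u w} R → (u , w) ∈ edges (x ∷ R ++ [ x ]) → u ∈ x ∷ R
    fst∈ R q with edge-fst (x ∷ R ++ [ x ]) q
    ... | here refl = here refl
    ... | there p   = ∈-snoc R p
    snd∈ : ∀ {u w} R → (u , w) ∈ edges (x ∷ R ++ [ x ]) → w ∈ x ∷ R
    snd∈ R q = ∈-snoc R (edge-snd x (R ++ [ x ]) q)
    -- an edge common to both cycles would have both endpoints equal to x
    cross : ∀ {e f} → e ∈ edges (x ∷ R₁ ++ [ x ]) → f ∈ edges (x ∷ R₂ ++ [ x ]) → NotSame e f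
    cross p q (inj₁ (refl , refl)) = adj-irr (edge-adj (x ∷ R₁ ++ [ x ]) (cycle-path cyc₁) p)
      (trans (only-x (fst∈ R₁ p) (fst∈ R₂ q)) (sym (only-x (snd∈ R₁ p) (snd∈ R₂ q))))
    cross p q (inj₂ (refl , refl)) = adj-irr (edge-adj (x ∷ R₁ ++ [ x ]) (cycle-path cyc₁) p)
      (trans (only-x (fst∈ R₁ p) (snd∈ R₂ q)) (sym (only-x (snd∈ R₁ p) (fst∈ R₂ q))))
    distinct : AllPairs NotSame (edges (x ∷ (R₁ ++ x ∷ R₂) ++ [ x ]))
    distinct = subst (AllPairs NotSame ∘ edges) (sym reassoc)
      (subst (AllPairs NotSame) (sym (edges-++ (x ∷ R₁) x (R₂ ++ [ x ])))
        (AllPairs.++⁺ (cycle-distinct cyc₁) (cycle-distinct cyc₂)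
          (All.tabulate λ p → All.tabulate λ q → cross p q)))
    even : even? (suc (length (R₁ ++ x ∷ R₂))) ≡ true
    even rewrite length-++ R₁ {x ∷ R₂} | even?-+ (length R₁) (suc (length R₂)) =
      odd+odd (even? (length R₁)) (even? (length R₂)) odd₁ odd₂
      where
      odd+odd : ∀ p q → not p ≡ false → not q ≡ false → not (if p then not q else not (not q)) ≡ true
      odd+odd true  true  _  _  = refl
      odd+odd false _     () _
      odd+odd true  false _  ()

  cycle-rot : ∀ {c} R₁ {x} R₂ → Cycle c (R₁ ++ x ∷ R₂) → Cycle x (R₂ ++ c ∷ R₁)
  cycle-rot {c} R₁ {x} R₂ (mkCycle u l p) = mkCycle u′ l′ p′
    where
    u′ : Uniq (x ∷ R₂ ++ c ∷ R₁)
    u′ = uniq-rot (c ∷ R₁) (x ∷ R₂) u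
    l′ : 2 ≤ length (R₂ ++ c ∷ R₁)
    l′ = subst (2 ≤_) (trans (length-++-sucʳ R₁ x R₂)
           (trans (cong suc (length-++-comm R₁ R₂)) (sym (length-++-sucʳ R₂ c R₁)))) l
    w : Path ((c ∷ R₁) ++ x ∷ (R₂ ++ [ c ]))
    w = subst Path (cong (c ∷_) (++-assoc R₁ (x ∷ R₂) [ c ])) p
    p′ : Path (x ∷ (R₂ ++ c ∷ R₁) ++ [ x ])
    p′ = subst Path (sym (cong (x ∷_) (++-assoc R₂ (c ∷ R₁) [ x ])))
          (path-glue (x ∷ R₂) c (R₁ ++ [ x ])
            (path-++ʳ (c ∷ R₁) x (R₂ ++ [ c ]) w)
            (path-++ˡ (c ∷ R₁) x (R₂ ++ [ c ]) w))

  cycle-rev : ∀ {c R} → Cycle c R → Cycle c (reverse R)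
  cycle-rev {c} {R} (mkCycle (c∉ ∷ u) l p) =
    mkCycle ((c∉ ∘ reverse⁻) ∷ uniq-rev u) (subst (2 ≤_) (sym (length-reverse R)) l) p′
    where
    eq : reverse (c ∷ R ++ [ c ]) ≡ c ∷ reverse R ++ [ c ]
    eq = trans (unfold-reverse c (R ++ [ c ])) (cong (_++ [ c ]) (reverse-++ R [ c ]))
    p′ : Path (c ∷ reverse R ++ [ c ])
    p′ = subst Path eq (path-rev (c ∷ R ++ [ c ]) p)

  -- Alternating sums along a walk: evenSum g W adds g over the 1st, 3rd, 5th, …
  -- edges of W, oddSum g W over the 2nd, 4th, … edges.
  evenSum oddSum : (V → V → ℕ) → List V → ℕ
  evenSum g (x ∷ W@(y ∷ r)) = g x y + oddSum g W
  evenSum g _               = 0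
  oddSum  g (x ∷ W@(y ∷ r)) = evenSum g W
  oddSum  g _               = 0

  evenSum-cong : ∀ {g h} W → Path W → (∀ u w → Adj u w → g u w ≡ h u w) → evenSum g W ≡ evenSum h W
  oddSum-cong  : ∀ {g h} W → Path W → (∀ u w → Adj u w → g u w ≡ h u w) → oddSum g W ≡ oddSum h W
  evenSum-cong []              p e = refl
  evenSum-cong (x ∷ [])        p e = refl
  evenSum-cong (x ∷ W@(y ∷ r)) (a , p) e = cong₂ _+_ (e x y a) (oddSum-cong W p e)
  oddSum-cong []              p e = refl
  oddSum-cong (x ∷ [])        p e = refl
  oddSum-cong (x ∷ W@(y ∷ r)) (a , p) e = evenSum-cong W p e

  evenSum-+ : ∀ g h W → evenSum (λ u w → g u w + h u w) W ≡ evenSum g W + evenSum h W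
  oddSum-+  : ∀ g h W → oddSum (λ u w → g u w + h u w) W ≡ oddSum g W + oddSum h W
  evenSum-+ g h []              = refl
  evenSum-+ g h (x ∷ [])        = refl
  evenSum-+ g h (x ∷ W@(y ∷ r)) rewrite oddSum-+ g h W = interchange (g x y) (h x y) (oddSum g W) (oddSum h W)
    where
    interchange : ∀ p q r s → p + q + (r + s) ≡ p + r + (q + s)
    interchange = solve-∀
  oddSum-+ g h []              = refl
  oddSum-+ g h (x ∷ [])        = refl
  oddSum-+ g h (x ∷ W@(y ∷ r)) = evenSum-+ g h W

  evenSum-*ʳ : ∀ g k W → evenSum (λ u w → g u w * k) W ≡ evenSum g W * k
  oddSum-*ʳ  : ∀ g k W → oddSum (λ u w → g u w * k) W ≡ oddSum g W * k
  evenSum-*ʳ g k []              = refl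
  evenSum-*ʳ g k (x ∷ [])        = refl
  evenSum-*ʳ g k (x ∷ W@(y ∷ r)) rewrite oddSum-*ʳ g k W = sym (*-distribʳ-+ k (g x y) (oddSum g W))
  oddSum-*ʳ g k []              = refl
  oddSum-*ʳ g k (x ∷ [])        = refl
  oddSum-*ʳ g k (x ∷ W@(y ∷ r)) = evenSum-*ʳ g k W

  evenSum-*ˡ : ∀ g k W → evenSum (λ u w → k * g u w) W ≡ k * evenSum g W
  oddSum-*ˡ  : ∀ g k W → oddSum (λ u w → k * g u w) W ≡ k * oddSum g W
  evenSum-*ˡ g k []              = sym (*-zeroʳ k)
  evenSum-*ˡ g k (x ∷ [])        = sym (*-zeroʳ k)
  evenSum-*ˡ g k (x ∷ W@(y ∷ r)) rewrite oddSum-*ˡ g k W = sym (*-distribˡ-+ k (g x y) (oddSum g W))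
  oddSum-*ˡ g k []              = sym (*-zeroʳ k)
  oddSum-*ˡ g k (x ∷ [])        = sym (*-zeroʳ k)
  oddSum-*ˡ g k (x ∷ W@(y ∷ r)) = evenSum-*ˡ g k W

  -- For a vertex weight f, the edge weight f u + f w telescopes along a walk.
  -- Hence on a closed walk of even length both alternating sums agree: every
  -- vertex is entered and left by an odd and an even edge.
  module Telescope (f : V → ℕ) where

    ends : V → V → ℕ
    ends u w = f u + f w

    final : V → List V → V
    final u []      = u
    final u (r ∷ R) = final r R

    telescope : ∀ u R →
      (even? (length R) ≡ true  → evenSum ends (u ∷ R) + f (final u R) ≡ oddSum ends (u ∷ R) + f u) ×
      (even? (length R) ≡ false → evenSum ends (u ∷ R) ≡ oddSum ends (u ∷ R) + f u + f (final u R))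
    telescope u []       = (λ _ → refl) , (λ ())
    telescope u (u₁ ∷ R) with telescope u₁ R
    ... | ih-even , ih-odd = even-case , odd-case
      where
      O = oddSum ends (u₁ ∷ R)
      Ev = evenSum ends (u₁ ∷ R)
      ℓ = f (final u₁ R)
      even-case : not (even? (length R)) ≡ true →
        f u + f u₁ + oddSum ends (u₁ ∷ R) + f (final u₁ R) ≡ evenSum ends (u₁ ∷ R) + f u
      even-case e rewrite ih-odd (not-true e) = shuffle (f u) (f u₁) O ℓ
        where
        shuffle : ∀ p q o l → p + q + o + l ≡ o + q + l + p
        shuffle = solve-∀
      odd-case : not (even? (length R)) ≡ false →
        f u + f u₁ + oddSum ends (u₁ ∷ R) ≡ evenSum ends (u₁ ∷ R) + f u + f (final u₁ R)
      odd-case e = begin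
        f u + f u₁ + O   ≡⟨ shuffle (f u) (f u₁) O ⟩
        O + f u₁ + f u   ≡⟨ cong (_+ f u) (sym (ih-even (not-false e))) ⟩
        Ev + ℓ + f u     ≡⟨ shuffle′ Ev ℓ (f u) ⟩
        Ev + f u + ℓ     ∎
        where
        open ≡-Reasoning
        shuffle : ∀ p q o → p + q + o ≡ o + q + p
        shuffle = solve-∀
        shuffle′ : ∀ p q r → p + q + r ≡ p + r + q
        shuffle′ = solve-∀

    final-snoc : ∀ u R w → final u (R ++ [ w ]) ≡ w
    final-snoc u []      w = refl
    final-snoc u (r ∷ R) w = final-snoc r R w

    balance : ∀ w R → even? (suc (length R)) ≡ true →
      evenSum ends (w ∷ R ++ [ w ]) ≡ oddSum ends (w ∷ R ++ [ w ])
    balance w R e = +-cancelʳ-≡ (f w) _ _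
      (subst (λ z → evenSum ends (w ∷ R ++ [ w ]) + f z ≡ oddSum ends (w ∷ R ++ [ w ]) + f w)
        (final-snoc w R w)
        (proj₁ (telescope w (R ++ [ w ])) (trans (cong even? (trans (length-++ R) (+-comm (length R) 1))) e)))

  one-even : ∀ {a b c Ra Rb Rc} → Cycle a Ra → Cycle b Rb → Cycle c Rc →
    even? (suc (length Ra) + suc (length Rb) + suc (length Rc)) ≡ true → EvenTrail
  one-even {Ra = Ra} {Rb} {Rc} Ca Cb Cc sum-even
    with even? (suc (length Ra)) in ea | even? (suc (length Rb)) in eb | even? (suc (length Rc)) in ec
  ... | true  | _     | _     = even-cycle Ca ea
  ... | false | true  | _     = even-cycle Cb eb
  ... | false | false | true  = even-cycle Cc ec
  ... | false | false | false = ⊥-elim (odd³ (trans (sym sum-even)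
        (trans (even?-+ (suc (length Ra) + suc (length Rb)) (suc (length Rc)))
               (cong₂ (λ p q → if p then q else not q)
                      (trans (even?-+ (suc (length Ra)) (suc (length Rb)))
                             (cong₂ (λ p q → if p then q else not q) ea eb)) ec))))
    where
    odd³ : true ≡ false → ⊥
    odd³ ()

  even?-double : ∀ n → even? (n + n) ≡ true
  even?-double zero    = refl
  even?-double (suc n) rewrite +-suc n n = cong not (cong not (even?-double n))

  1≤length-snoc : ∀ X {z : V} → 1 ≤ length (X ++ [ z ])
  1≤length-snoc X = subst (1 ≤_) (sym (length-++ X)) (m≤n+m 1 (length X))

  close-path : ∀ {c x z} X → Uniq (c ∷ x ∷ X ++ [ z ]) → Path (c ∷ x ∷ X ++ [ z ]) →
    Adj z c → Cycle c (x ∷ X ++ [ z ])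
  close-path {c} {x} {z} X u p a = mkCycle u (s≤s (1≤length-snoc X)) closed
    where
    closed : Path (c ∷ (x ∷ X ++ [ z ]) ++ [ c ])
    closed = subst Path (cong (λ L → c ∷ x ∷ L) (sym (++-assoc X [ z ] [ c ])))
      (path-glue (c ∷ x ∷ X) z [ c ] p (a , tt))

  ear-cycle : ∀ {x z} R₁ R₂ Q → Cycle x (R₁ ++ z ∷ R₂) → Path (z ∷ Q ++ [ x ]) → Uniq Q →
    Disj Q (x ∷ R₁ ++ z ∷ R₂) → 2 ≤ length R₁ + suc (length Q) → Cycle x (R₁ ++ z ∷ Q)
  ear-cycle {x} {z} R₁ R₂ Q cyc ear uQ away long = mkCycle uniq long′ closed
    where
    arc-uniq : Uniq (x ∷ R₁ ++ [ z ])
    arc-uniq = uniq-prefix (x ∷ R₁) z R₂ (cycle-uniq cyc)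
    uniq : Uniq (x ∷ R₁ ++ z ∷ Q)
    uniq = subst Uniq (cong (x ∷_) (++-assoc R₁ [ z ] Q))
      (uniq-++⁺ arc-uniq uQ (λ p q → away q (∈-prefix (x ∷ R₁) p)))
    long′ : 2 ≤ length (R₁ ++ z ∷ Q)
    long′ = subst (2 ≤_) (sym (length-++ R₁)) long
    arc : Path (x ∷ R₁ ++ [ z ])
    arc = path-++ˡ (x ∷ R₁) z (R₂ ++ [ x ])
      (subst Path (cong (x ∷_) (++-assoc R₁ (z ∷ R₂) [ x ])) (cycle-path cyc))
    closed : Path (x ∷ (R₁ ++ z ∷ Q) ++ [ x ])
    closed = subst Path (cong (x ∷_) (sym (++-assoc R₁ (z ∷ Q) [ x ])))
      (path-glue (x ∷ R₁) z (Q ++ [ x ]) arc ear)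

  cycle-rev-split : ∀ {x z} R₁ R₂ → Cycle x (R₁ ++ z ∷ R₂) → Cycle x (reverse R₂ ++ z ∷ reverse R₁)
  cycle-rev-split {x} {z} R₁ R₂ cyc = subst (Cycle x) eq (cycle-rev cyc)
    where
    eq : reverse (R₁ ++ z ∷ R₂) ≡ reverse R₂ ++ z ∷ reverse R₁
    eq = trans (reverse-++ R₁ (z ∷ R₂))
      (trans (cong (_++ reverse R₁) (unfold-reverse z R₂)) (++-assoc (reverse R₂) [ z ] (reverse R₁)))

  -- Theta graphs: a cycle together with a second path between two of its
  -- vertices, internally disjoint from it, contains an even cycle, because the
  -- three cycles so formed have even total length.
  theta : ∀ {x z} R₁ R₂ Q → Cycle x (R₁ ++ z ∷ R₂) → Path (z ∷ Q ++ [ x ]) → Uniq Q →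
    Disj Q (x ∷ R₁ ++ z ∷ R₂) → 2 ≤ length R₁ + suc (length Q) →
    2 ≤ length R₂ + suc (length Q) → EvenTrail
  theta {x} {z} R₁ R₂ Q cyc ear uQ away long₁ long₂ = one-even cyc K₁ K₂ total-even
    where
    K₁ : Cycle x (R₁ ++ z ∷ Q)
    K₁ = ear-cycle R₁ R₂ Q cyc ear uQ away long₁
    reversed : ∀ {w} → w ∈ x ∷ reverse R₂ ++ z ∷ reverse R₁ → w ∈ x ∷ R₁ ++ z ∷ R₂
    reversed (here refl) = here refl
    reversed (there q) with ∈-++⁻ (reverse R₂) q
    ... | inj₁ r = there (∈-++⁺ʳ R₁ (there (reverse⁻ {xs = R₂} r)))
    ... | inj₂ (here refl) = there (∈-++⁺ʳ R₁ (here refl))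
    ... | inj₂ (there r) = there (∈-++⁺ˡ (reverse⁻ {xs = R₁} r))
    K₂ : Cycle x (reverse R₂ ++ z ∷ Q)
    K₂ = ear-cycle (reverse R₂) (reverse R₁) Q (cycle-rev-split R₁ R₂ cyc) ear uQ
      (λ p q → away p (reversed q)) (subst (λ n → 2 ≤ n + suc (length Q)) (sym (length-reverse R₂)) long₂)
    total-even : even? (suc (length (R₁ ++ z ∷ R₂)) + suc (length (R₁ ++ z ∷ Q))
                        + suc (length (reverse R₂ ++ z ∷ Q))) ≡ true
    total-even rewrite length-++ R₁ {z ∷ R₂} | length-++ R₁ {z ∷ Q} | length-++ (reverse R₂) {z ∷ Q}
                     | length-reverse R₂ =
      subst (λ n → even? n ≡ true) (double (length R₁) (length R₂) (length Q))
            (even?-double (length R₁ + length R₂ + length Q + 3))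
      where
      double : ∀ r₁ r₂ e → (r₁ + r₂ + e + 3) + (r₁ + r₂ + e + 3)
                         ≡ suc (r₁ + suc r₂) + suc (r₁ + suc e) + suc (r₂ + suc e)
      double = solve-∀

  at-one-vertex : ∀ {x R₁ R₂} → Cycle x R₁ → Cycle x R₂ → Disj R₁ (x ∷ R₂) → EvenTrail
  at-one-vertex {x} {R₁} {R₂} cyc₁ cyc₂ disjoint
    with even? (suc (length R₁)) in e₁ | even? (suc (length R₂)) in e₂
  ... | true  | _    = even-cycle cyc₁ e₁
  ... | false | true = even-cycle cyc₂ e₂
  ... | false | false = bowtie cyc₁ cyc₂ disjoint e₁ e₂

  data LastSplit (P : V → Set) : List V → Set where
    none : ∀ {L} → All (¬_ ∘ P) L → LastSplit P L
    last : ∀ A z B → P z → All (¬_ ∘ P) B → LastSplit P (A ++ z ∷ B)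

  lastSplit : ∀ {P : V → Set} → Decidable P → ∀ L → LastSplit P L
  lastSplit P? [] = none []
  lastSplit P? (h ∷ t) with lastSplit P? t
  ... | last A z B pz away = last (h ∷ A) z B pz away
  ... | none away with P? h
  ... | yes ph  = last [] h t ph away
  ... | no  ¬ph = none (¬ph ∷ away)

  off-++ : ∀ {p₀ K} A → All (_∉ K) A → p₀ ∉ K → Disj (A ++ [ p₀ ]) K
  off-++ A away p₀∉ p q with ∈-++⁻ A p
  ... | inj₁ r = All.lookup away r q
  ... | inj₂ (here refl) = p₀∉ q

  -- A cycle through the edge p₀x and a cycle through x avoiding p₀ together
  -- contain an even closed trail.  Let z be the last vertex of the first cycle
  -- (before returning to p₀) lying on the second one: if there is none the
  -- cycles meet only at x, otherwise z ≠ x and the first cycle supplies a path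
  -- z … p₀ x, internally disjoint from the second cycle (a theta graph).
  share : ∀ {p₀ x A R} → Cycle p₀ (x ∷ A) → Cycle x R → p₀ ∉ x ∷ R → EvenTrail
  share {p₀} {x} {A} {R} cyc cyc′ p₀∉ with lastSplit (_∈ᴸ? (x ∷ R)) A
  ... | none away = at-one-vertex (cycle-rot [] A cyc) cyc′ (off-++ A away p₀∉)
  ... | last A₁ z A₂ (here refl) away = ⊥-elim (uhead (utail (cycle-uniq cyc)) (∈-++⁺ʳ A₁ (here refl)))
  ... | last A₁ z A₂ (there z∈R) away with ∈-∃++ z∈R
  ...   | R₁ , R₂ , refl =
    theta R₁ R₂ (A₂ ++ [ p₀ ]) cyc′ ear uniq (off-++ A₂ away p₀∉) (long (length R₁)) (long (length R₂))
    where
    u : Uniq (p₀ ∷ x ∷ A₁ ++ z ∷ A₂)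
    u = cycle-uniq cyc
    uniq : Uniq (A₂ ++ [ p₀ ])
    uniq = uniq-++⁺ (utail (proj₁ (proj₂ (uniq-++⁻ A₁ (utail (utail u)))))) ((λ ()) ∷ [])
      (λ { p (here refl) → uhead u (there (∈-++⁺ʳ A₁ (there p))) })
    to-p₀ : Path (z ∷ A₂ ++ [ p₀ ])
    to-p₀ = path-++ʳ (p₀ ∷ x ∷ A₁) z (A₂ ++ [ p₀ ])
      (subst Path (cong (λ L → p₀ ∷ x ∷ L) (++-assoc A₁ (z ∷ A₂) [ p₀ ])) (cycle-path cyc))
    ear : Path (z ∷ (A₂ ++ [ p₀ ]) ++ [ x ])
    ear = subst Path (cong (z ∷_) (sym (++-assoc A₂ [ p₀ ] [ x ])))
      (path-glue (z ∷ A₂) p₀ [ x ] to-p₀ (proj₁ (cycle-path cyc) , tt))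
    long : ∀ m → 2 ≤ m + suc (length (A₂ ++ [ p₀ ]))
    long m = ≤-trans (s≤s (1≤length-snoc A₂)) (m≤n+m _ m)

  count : (V → Bool) → List V → ℕ
  count f []       = 0
  count f (x ∷ xs) = bit (f x) + count f xs

  eq? : V → V → Bool
  eq? x y = ⌊ x ≟ y ⌋

  rm : V → List V → List V
  rm u []       = []
  rm u (x ∷ xs) = if eq? x u then rm u xs else x ∷ rm u xs

  deg : V → List V → ℕ
  deg u S = count (E u) S

  edgeCount : List V → ℕ
  edgeCount []      = 0
  edgeCount (u ∷ S) = deg u S + edgeCount S

  nonempty : ∀ {m} S → length S ≡ suc m → Σ[ s ∈ V ] s ∈ S
  nonempty (s ∷ _) _ = s , here refl

  eq?-refl : ∀ x → eq? x x ≡ true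
  eq?-refl x with x ≟ x
  ... | yes _   = refl
  ... | no x≢x = ⊥-elim (x≢x refl)

  eq?-≢ : ∀ {x y} → x ≢ y → eq? x y ≡ false
  eq?-≢ {x} {y} x≢y with x ≟ y
  ... | yes x≡y = ⊥-elim (x≢y x≡y)
  ... | no _    = refl

  rm-∉ : ∀ u S → u ∉ S → rm u S ≡ S
  rm-∉ u []      u∉ = refl
  rm-∉ u (x ∷ S) u∉ with x ≟ u
  ... | yes refl = ⊥-elim (u∉ (here refl))
  ... | no _     = cong (x ∷_) (rm-∉ u S (u∉ ∘ there))

  rm-⊆ : ∀ {w} u S → w ∈ rm u S → w ∈ S
  rm-⊆ u (x ∷ S) q with x ≟ u
  ... | yes _ = there (rm-⊆ u S q)
  rm-⊆ u (x ∷ S) (here e)  | no _ = here e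
  rm-⊆ u (x ∷ S) (there q) | no _ = there (rm-⊆ u S q)

  rm-≢ : ∀ {w} u S → w ∈ rm u S → w ≢ u
  rm-≢ u (x ∷ S) q with x ≟ u
  ... | yes _ = rm-≢ u S q
  rm-≢ u (x ∷ S) (here refl) | no x≢u = x≢u
  rm-≢ u (x ∷ S) (there q)   | no _   = rm-≢ u S q

  rm-∈ : ∀ {w} u S → w ∈ S → w ≢ u → w ∈ rm u S
  rm-∈ u (x ∷ S) q w≢u with x ≟ u
  rm-∈ u (x ∷ S) (here refl) w≢u | yes refl = ⊥-elim (w≢u refl)
  rm-∈ u (x ∷ S) (there q)   w≢u | yes _    = rm-∈ u S q w≢u
  rm-∈ u (x ∷ S) (here e)    w≢u | no _     = here e
  rm-∈ u (x ∷ S) (there q)   w≢u | no _     = there (rm-∈ u S q w≢u)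

  rm-uniq : ∀ u {S} → Uniq S → Uniq (rm u S)
  rm-uniq u [] = []
  rm-uniq u {x ∷ S} (x∉ ∷ us) with x ≟ u
  ... | yes _ = rm-uniq u us
  ... | no _  = (x∉ ∘ rm-⊆ u S) ∷ rm-uniq u us

  rm-length : ∀ u {S} → Uniq S → u ∈ S → length S ≡ suc (length (rm u S))
  rm-length u {x ∷ S} (x∉ ∷ us) q with x ≟ u
  ... | yes refl = cong suc (cong length (sym (rm-∉ x S x∉)))
  rm-length u {x ∷ S} (x∉ ∷ us) (here refl) | no x≢u = ⊥-elim (x≢u refl)
  rm-length u {x ∷ S} (x∉ ∷ us) (there q)   | no _   = cong suc (rm-length u us q)

  rm-length≤ : ∀ u {S} → Uniq S → length S ≤ suc (length (rm u S))
  rm-length≤ u {S} us with u ∈ᴸ? S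
  ... | yes q  = ≤-reflexive (rm-length u us q)
  ... | no u∉ = subst (λ L → length S ≤ suc (length L)) (sym (rm-∉ u S u∉)) (n≤1+n _)

  count-rm : ∀ f u {S} → Uniq S → u ∈ S → count f S ≡ bit (f u) + count f (rm u S)
  count-rm f u {x ∷ S} (x∉ ∷ us) q with x ≟ u
  ... | yes refl = cong (bit (f x) +_) (cong (count f) (sym (rm-∉ x S x∉)))
  count-rm f u {x ∷ S} (x∉ ∷ us) (here refl) | no x≢u = ⊥-elim (x≢u refl)
  count-rm f u {x ∷ S} (x∉ ∷ us) (there q)   | no _ rewrite count-rm f u us q =
    swap (bit (f x)) (bit (f u)) (count f (rm u S))
    where
    swap : ∀ p q r → p + (q + r) ≡ q + (p + r)
    swap = solve-∀

  edgeCount-rm : ∀ u {S} → Uniq S → u ∈ S → edgeCount S ≡ deg u (rm u S) + edgeCount (rm u S)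
  edgeCount-rm u {x ∷ S} (x∉ ∷ us) q with x ≟ u
  ... | yes refl rewrite rm-∉ x S x∉ = refl
  edgeCount-rm u {x ∷ S} (x∉ ∷ us) (here refl) | no x≢u = ⊥-elim (x≢u refl)
  edgeCount-rm u {x ∷ S} (x∉ ∷ us) (there q)   | no _
    rewrite edgeCount-rm u us q | count-rm (E x) u us q | E-sym x u =
    interchange (bit (E u x)) (count (E u) (rm u S)) (count (E x) (rm u S)) (edgeCount (rm u S))
    where
    interchange : ∀ p q r s → (p + r) + (q + s) ≡ (p + q) + (r + s)
    interchange = solve-∀

  count-rm≤ : ∀ f u S → count f (rm u S) ≤ count f S
  count-rm≤ f u []      = z≤n
  count-rm≤ f u (x ∷ S) with eq? x u
  ... | true  = ≤-trans (count-rm≤ f u S) (m≤n+m _ _)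
  ... | false = +-monoʳ-≤ (bit (f x)) (count-rm≤ f u S)

  count-mono : ∀ {f g} S → (∀ {z} → z ∈ S → f z ≡ true → g z ≡ true) → count f S ≤ count g S
  count-mono []      f⇒g = z≤n
  count-mono (x ∷ S) f⇒g = +-mono-≤ (bit-mono (f⇒g (here refl))) (count-mono S (f⇒g ∘ there))

  count-strict : ∀ {f g y} S → (∀ {z} → z ∈ S → f z ≡ true → g z ≡ true) → y ∈ S →
    f y ≡ false → g y ≡ true → count f S < count g S
  count-strict (x ∷ S) f⇒g (here refl) fy gy rewrite fy | gy = s≤s (count-mono S (f⇒g ∘ there))
  count-strict (x ∷ S) f⇒g (there q)   fy gy =
    +-mono-≤-< (bit-mono (f⇒g (here refl))) (count-strict S (f⇒g ∘ there) q fy gy)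

  count-zero : ∀ f S → (∀ {z} → z ∈ S → f z ≡ false) → count f S ≡ 0
  count-zero f []      never = refl
  count-zero f (x ∷ S) never rewrite never (here refl) = count-zero f S (never ∘ there)

  count-sum : ∀ f g h S → (∀ {z} → z ∈ S → bit (f z) ≤ bit (g z) + bit (h z)) →
    count f S ≤ count g S + count h S
  count-sum f g h []      le = z≤n
  count-sum f g h (x ∷ S) le =
    ≤-trans (+-mono-≤ (le (here refl)) (count-sum f g h S (le ∘ there)))
            (≤-reflexive (interchange (bit (g x)) (bit (h x)) (count g S) (count h S)))
    where
    interchange : ∀ p q r s → (p + q) + (r + s) ≡ (p + r) + (q + s)
    interchange = solve-∀

  count-eq? : ∀ a {S} → Uniq S → count (λ y → eq? y a) S ≤ 1
  count-eq? a [] = z≤n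
  count-eq? a {x ∷ S} (x∉ ∷ us) with x ≟ a
  ... | yes refl = s≤s (≤-reflexive (count-zero _ S (λ q → eq?-≢ (λ { refl → x∉ q }))))
  ... | no _     = count-eq? a us

  count≤2 : ∀ f a b {S} → Uniq S → (∀ {y} → y ∈ S → f y ≡ true → y ≡ a ⊎ y ≡ b) → count f S ≤ 2
  count≤2 f a b {S} us only =
    ≤-trans (count-sum f (λ y → eq? y a) (λ y → eq? y b) S at-a-or-b)
            (+-mono-≤ (count-eq? a us) (count-eq? b us))
    where
    at-a-or-b : ∀ {y} → y ∈ S → bit (f y) ≤ bit (eq? y a) + bit (eq? y b)
    at-a-or-b {y} q with f y in fy
    ... | false = z≤n
    ... | true with only q fy
    ...   | inj₁ refl rewrite eq?-refl a = s≤s z≤n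
    ...   | inj₂ refl rewrite eq?-refl b = m≤n+m 1 (bit (eq? b a))

  count-1 : ∀ f S → 1 ≤ count f S → Σ[ y ∈ V ] y ∈ S × f y ≡ true
  count-1 f (x ∷ S) h with f x in fx
  ... | true  = x , here refl , fx
  ... | false = let (y , q , fy) = count-1 f S h in y , there q , fy

  count-2 : ∀ f {S} → Uniq S → 2 ≤ count f S →
    Σ[ y₁ ∈ V ] Σ[ y₂ ∈ V ] y₁ ∈ S × y₂ ∈ S × f y₁ ≡ true × f y₂ ≡ true × y₁ ≢ y₂
  count-2 f {x ∷ S} (x∉ ∷ us) h with f x in fx
  ... | true  = let (y , q , fy) = count-1 f S (≤-pred h)
                in x , y , here refl , there q , fx , fy , (λ { refl → x∉ q })
  ... | false = let (y₁ , y₂ , q₁ , q₂ , f₁ , f₂ , y₁≢y₂) = count-2 f us h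
                in y₁ , y₂ , there q₁ , there q₂ , f₁ , f₂ , y₁≢y₂

  length≤1 : ∀ s {U} → Uniq U → (∀ {w} → w ∈ U → w ≡ s) → length U ≤ 1
  length≤1 s []           all-s = z≤n
  length≤1 s {x ∷ []}     _     all-s = s≤s z≤n
  length≤1 s {x ∷ y ∷ U} (x∉ ∷ _) all-s =
    ⊥-elim (x∉ (here (trans (all-s (here refl)) (sym (all-s (there (here refl)))))))

  Adj? : ∀ x y → Dec (Adj x y)
  Adj? x y = E x y Bool.≟ true

  record MaximalPath (S : List V) : Set where
    constructor mkMaximalPath
    field
      origin  : V
      onward  : List V
      mp-uniq    : Uniq (origin ∷ onward)
      mp-inside  : ∀ {y} → y ∈ origin ∷ onward → y ∈ S
      mp-path    : Path (origin ∷ onward)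
      mp-maximal : ∀ {y} → y ∈ S → Adj origin y → y ∈ origin ∷ onward

  -- notIn P y: y is not on P.  The number of vertices of S off the path is
  -- the measure that decreases when the path is extended.
  notIn : List V → V → Bool
  notIn P y = not ⌊ y ∈ᴸ? P ⌋

  notIn-true : ∀ {P y} → notIn P y ≡ true → y ∉ P
  notIn-true {P} {y} e q with y ∈ᴸ? P
  ... | no y∉P = y∉P q

  notIn-false : ∀ {P y} → y ∈ P → notIn P y ≡ false
  notIn-false {P} {y} q with y ∈ᴸ? P
  ... | yes _   = refl
  ... | no y∉P = ⊥-elim (y∉P q)

  notIn-intro : ∀ {P y} → y ∉ P → notIn P y ≡ true
  notIn-intro {P} {y} y∉P with y ∈ᴸ? P
  ... | yes q = ⊥-elim (y∉P q)
  ... | no _  = refl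

  extend : ∀ S k p₀ T → count (notIn (p₀ ∷ T)) S ≤ k → Uniq (p₀ ∷ T) →
    (∀ {y} → y ∈ p₀ ∷ T → y ∈ S) → Path (p₀ ∷ T) → MaximalPath S
  extend S k p₀ T bound u in-S path with any? (λ y → Adj? p₀ y ×-dec ¬? (y ∈ᴸ? (p₀ ∷ T))) S
  ... | no none-new = mkMaximalPath p₀ T u in-S path maximal
    where
    maximal : ∀ {y} → y ∈ S → Adj p₀ y → y ∈ p₀ ∷ T
    maximal {y} y∈S a with y ∈ᴸ? (p₀ ∷ T)
    ... | yes on = on
    ... | no off = ⊥-elim (none-new (lose y∈S (a , off)))
  ... | yes new with find new
  ...   | y , y∈S , a , y∉ = grow k bound
    where
    shrinks : count (notIn (y ∷ p₀ ∷ T)) S < count (notIn (p₀ ∷ T)) S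
    shrinks = count-strict S (λ _ e → notIn-intro (notIn-true e ∘ there))
      y∈S (notIn-false (here refl)) (notIn-intro y∉)
    grow : ∀ k → count (notIn (p₀ ∷ T)) S ≤ k → MaximalPath S
    grow zero    bound with ≤-trans shrinks bound
    ... | ()
    grow (suc k) bound = extend S k y (p₀ ∷ T) (≤-pred (≤-trans shrinks bound)) (y∉ ∷ u)
      (λ { (here refl) → y∈S ; (there q) → in-S q }) (adj-sym a , path)

  maximal-path : ∀ {s} S → s ∈ S → MaximalPath S
  maximal-path {s} S s∈S =
    extend S _ s [] ≤-refl ((λ ()) ∷ []) (λ { (here refl) → s∈S }) tt

  before-last : ∀ {p₀ y w} A B → y ∈ p₀ ∷ A ++ w ∷ B → Adj p₀ y → All (¬_ ∘ Adj p₀) B →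
    y ∈ A ++ [ w ]
  before-last A B (here refl) a away = ⊥-elim (adj-irr a refl)
  before-last A B (there q)   a away with ∈-++⁻ A q
  ... | inj₁ r           = ∈-++⁺ˡ r
  ... | inj₂ (here refl) = ∈-++⁺ʳ A (here refl)
  ... | inj₂ (there r)   = ⊥-elim (All.lookup away r a)

  -- A chord p₀y of a cycle p₀ ∷ p₁ ∷ A ++ [ w ] (with y inside A) forms a theta graph.
  chord : ∀ {p₀ p₁ w y} A → Cycle p₀ (p₁ ∷ A ++ [ w ]) → y ∈ A → Adj y p₀ → EvenTrail
  chord {p₀} {p₁} {w} {y} A cyc y∈A a with ∈-∃++ y∈A
  ... | N₁ , N₂ , refl = theta (p₁ ∷ N₁) (N₂ ++ [ w ]) [] cyc′ (a , tt) [] (λ ()) long₁ long₂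
    where
    cyc′ : Cycle p₀ ((p₁ ∷ N₁) ++ y ∷ (N₂ ++ [ w ]))
    cyc′ = subst (λ L → Cycle p₀ (p₁ ∷ L)) (++-assoc N₁ (y ∷ N₂) [ w ]) cyc
    long₁ : 2 ≤ length (p₁ ∷ N₁) + 1
    long₁ = s≤s (m≤n+m 1 (length N₁))
    long₂ : 2 ≤ length (N₂ ++ [ w ]) + 1
    long₂ = +-monoˡ-≤ 1 (1≤length-snoc N₂)

  rotate-to : ∀ {c R x} → Cycle c R → x ∈ c ∷ R →
    Σ[ R′ ∈ List V ] Cycle x R′ × (∀ {y} → y ∈ x ∷ R′ → y ∈ c ∷ R)
  rotate-to {c} {R} cyc (here refl) = R , cyc , λ q → q
  rotate-to {c} {R} {x} cyc (there q) with ∈-∃++ q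
  ... | R₁ , R₂ , refl = R₂ ++ c ∷ R₁ , cycle-rot R₁ R₂ cyc , back
    where
    back : ∀ {y} → y ∈ x ∷ R₂ ++ c ∷ R₁ → y ∈ c ∷ R₁ ++ x ∷ R₂
    back r with ∈-++⁻ (x ∷ R₂) r
    ... | inj₁ r₁ = there (∈-++⁺ʳ R₁ r₁)
    ... | inj₂ (here refl) = here refl
    ... | inj₂ (there r₂) = there (∈-++⁺ˡ r₂)

  -- The extremal bound is proved for a graph on a list S of distinct vertices
  -- together with a list U ⊆ S of "hot" vertices: any cycle inside S through a
  -- hot vertex is known to yield an even closed trail.  Then either there is
  -- an even closed trail or 3·e(S) + 3 + |U| ≤ 4·|S|.
  Hot : List V → List V → Set
  Hot S U = ∀ {w} → w ∈ U → ∀ {c R} → Cycle c R → (∀ {y} → y ∈ c ∷ R → y ∈ S) →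
    w ∈ c ∷ R → EvenTrail

  Outcome : ℕ → List V → List V → Set
  Outcome n S U = EvenTrail ⊎ (3 * edgeCount S + 3 + length U ≤ 4 * suc n)

  Bound : ℕ → Set
  Bound n = ∀ S → length S ≡ suc n → Uniq S → ∀ U → Uniq U → (∀ {w} → w ∈ U → w ∈ S) →
    Hot S U → Outcome n S U

  -- The arithmetic of the two reduction steps: deleting a vertex of degree ≤ 1
  -- (losing at most one hot vertex), or of degree 2 (making two vertices hot).
  four-more : ∀ n → 4 * suc n + 4 ≡ 4 * suc (suc n)
  four-more = solve-∀

  leaf-arith : ∀ d e u u′ n → d ≤ 1 → 3 * e + 3 + u′ ≤ 4 * suc n → u ≤ suc u′ →
    3 * (d + e) + 3 + u ≤ 4 * suc (suc n)
  leaf-arith d e u u′ n d≤1 ih u≤ = begin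
    3 * (d + e) + 3 + u      ≤⟨ +-mono-≤ (+-monoˡ-≤ 3 (*-monoʳ-≤ 3 (+-monoˡ-≤ e d≤1))) u≤ ⟩
    3 * (1 + e) + 3 + suc u′ ≡⟨ regroup e u′ ⟩
    (3 * e + 3 + u′) + 4     ≤⟨ +-monoˡ-≤ 4 ih ⟩
    4 * suc n + 4            ≡⟨ four-more n ⟩
    4 * suc (suc n)          ∎
    where
    open ≤-Reasoning
    regroup : ∀ e u′ → 3 * (1 + e) + 3 + suc u′ ≡ (3 * e + 3 + u′) + 4
    regroup = solve-∀

  degree-two-arith : ∀ d e u n → d ≤ 2 → 3 * e + 3 + suc (suc u) ≤ 4 * suc n →
    3 * (d + e) + 3 + u ≤ 4 * suc (suc n)
  degree-two-arith d e u n d≤2 ih = begin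
    3 * (d + e) + 3 + u               ≤⟨ +-monoˡ-≤ u (+-monoˡ-≤ 3 (*-monoʳ-≤ 3 (+-monoˡ-≤ e d≤2))) ⟩
    3 * (2 + e) + 3 + u               ≡⟨ regroup e u ⟩
    (3 * e + 3 + suc (suc u)) + 4     ≤⟨ +-monoˡ-≤ 4 ih ⟩
    4 * suc n + 4                     ≡⟨ four-more n ⟩
    4 * suc (suc n)                   ∎
    where
    open ≤-Reasoning
    regroup : ∀ e u → 3 * (2 + e) + 3 + u ≡ (3 * e + 3 + suc (suc u)) + 4
    regroup = solve-∀

  module Step (n : ℕ) (ih : Bound n) (S : List V) (len : length S ≡ suc (suc n)) (us : Uniq S)
    (U : List V) (uU : Uniq U) (U⊆S : ∀ {w} → w ∈ U → w ∈ S) (hot : Hot S U) where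

    remove-leaf : ∀ {u} → u ∈ S → deg u S ≤ 1 → Outcome (suc n) S U
    remove-leaf {u} u∈S leaf =
      map₂ bound (ih (rm u S) len′ (rm-uniq u us) (rm u U) (rm-uniq u uU) sub′ hot′)
      where
      len′ : length (rm u S) ≡ suc n
      len′ = suc-injective (trans (sym (rm-length u us u∈S)) len)
      sub′ : ∀ {w} → w ∈ rm u U → w ∈ rm u S
      sub′ q = rm-∈ u S (U⊆S (rm-⊆ u U q)) (rm-≢ u U q)
      hot′ : Hot (rm u S) (rm u U)
      hot′ q cyc in-S = hot (rm-⊆ u U q) cyc (rm-⊆ u S ∘ in-S)
      bound : 3 * edgeCount (rm u S) + 3 + length (rm u U) ≤ 4 * suc n →
              3 * edgeCount S + 3 + length U ≤ 4 * suc (suc n)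
      bound h = subst (λ t → 3 * t + 3 + length U ≤ 4 * suc (suc n)) (sym (edgeCount-rm u us u∈S))
        (leaf-arith (deg u (rm u S)) (edgeCount (rm u S)) (length U) (length (rm u U)) n
          (≤-trans (count-rm≤ (E u) u S) leaf) h (rm-length≤ u uU))

    -- Delete a vertex p₀ whose only neighbours are p₁ and w, where p₀ ∷ p₁ ∷ A ++ [ w ]
    -- is a cycle K.  Unless K meets a hot vertex, p₁ and w become hot: by
    -- `share`, a cycle through one of them avoiding p₀ combines with K.
    remove-degree-two : ∀ {p₀ p₁ w} A → Cycle p₀ (p₁ ∷ A ++ [ w ]) →
      (∀ {y} → y ∈ p₀ ∷ p₁ ∷ A ++ [ w ] → y ∈ S) →
      (∀ {y} → y ∈ S → Adj p₀ y → y ≡ p₁ ⊎ y ≡ w) → Outcome (suc n) S U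
    remove-degree-two {p₀} {p₁} {w} A K K⊆S only with p₀ ∈ᴸ? U | p₁ ∈ᴸ? U | w ∈ᴸ? U
    ... | yes q | _     | _     = inj₁ (hot q K K⊆S (here refl))
    ... | no _  | yes q | _     = inj₁ (hot q K K⊆S (there (here refl)))
    ... | no _  | no _  | yes q = inj₁ (hot q K K⊆S (there (there (∈-++⁺ʳ A (here refl)))))
    ... | no p₀∉U | no p₁∉U | no w∉U =
      map₂ bound (ih S′ len′ (rm-uniq p₀ us) (p₁ ∷ w ∷ U) uU′ sub′ hot′)
      where
      S′ = rm p₀ S
      p₀∈S = K⊆S (here refl)
      p₁∈S = K⊆S (there (here refl))
      w∈S  = K⊆S (there (there (∈-++⁺ʳ A (here refl))))
      p₁≢w : p₁ ≢ w
      p₁≢w refl = uhead (utail (cycle-uniq K)) (∈-++⁺ʳ A (here refl))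
      len′ : length S′ ≡ suc n
      len′ = suc-injective (trans (sym (rm-length p₀ us p₀∈S)) len)
      uU′ : Uniq (p₁ ∷ w ∷ U)
      uU′ = (λ { (here e) → p₁≢w e ; (there q) → p₁∉U q }) ∷ (w∉U ∷ uU)
      sub′ : ∀ {y} → y ∈ p₁ ∷ w ∷ U → y ∈ S′
      sub′ (here refl)         = rm-∈ p₀ S p₁∈S (λ e → uhead (cycle-uniq K) (here (sym e)))
      sub′ (there (here refl)) = rm-∈ p₀ S w∈S
        (λ e → uhead (cycle-uniq K) (there (∈-++⁺ʳ A (here (sym e)))))
      sub′ (there (there q))   = rm-∈ p₀ S (U⊆S q) (λ { refl → p₀∉U q })
      K-rev : Cycle p₀ (w ∷ reverse A ++ [ p₁ ])
      K-rev = subst (Cycle p₀) (trans (unfold-reverse p₁ (A ++ [ w ]))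
        (cong (_++ [ p₁ ]) (reverse-++ A [ w ]))) (cycle-rev K)
      hot′ : Hot S′ (p₁ ∷ w ∷ U)
      hot′ (here refl) cyc in-S on with rotate-to cyc on
      ... | _ , cyc′ , back = share K cyc′ (λ q → rm-≢ p₀ S (in-S (back q)) refl)
      hot′ (there (here refl)) cyc in-S on with rotate-to cyc on
      ... | _ , cyc′ , back = share K-rev cyc′ (λ q → rm-≢ p₀ S (in-S (back q)) refl)
      hot′ (there (there q)) cyc in-S on = hot q cyc (rm-⊆ p₀ S ∘ in-S) on
      bound : 3 * edgeCount S′ + 3 + length (p₁ ∷ w ∷ U) ≤ 4 * suc n →
              3 * edgeCount S + 3 + length U ≤ 4 * suc (suc n)
      bound h = subst (λ t → 3 * t + 3 + length U ≤ 4 * suc (suc n)) (sym (edgeCount-rm p₀ us p₀∈S))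
        (degree-two-arith (deg p₀ S′) (edgeCount S′) (length U) n
          (count≤2 (E p₀) p₁ w (rm-uniq p₀ us) (λ q a → only (rm-⊆ p₀ S q) a)) h)

    -- Let p₀ ∷ p₁ ∷ A ++ w ∷ B be a maximal path in which w is the last
    -- neighbour of p₀, closing the cycle K = p₀ ∷ p₁ ∷ A ++ [ w ].  A third
    -- neighbour of p₀ is a chord of K; otherwise p₀ has degree two.
    last-neighbour : ∀ {p₀ p₁ w} A B → Uniq (p₀ ∷ p₁ ∷ A ++ w ∷ B) →
      (∀ {y} → y ∈ p₀ ∷ p₁ ∷ A ++ w ∷ B → y ∈ S) → Path (p₀ ∷ p₁ ∷ A ++ w ∷ B) →
      (∀ {y} → y ∈ S → Adj p₀ y → y ∈ p₀ ∷ p₁ ∷ A ++ w ∷ B) →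
      Adj p₀ w → All (¬_ ∘ Adj p₀) B → Outcome (suc n) S U
    last-neighbour {p₀} {p₁} {w} A B u in-S path maximal aw away
      with any? (λ y → Adj? p₀ y ×-dec (¬? (y ≟ p₁) ×-dec ¬? (y ≟ w))) S
    ... | yes third with find third
    ...   | y , y∈S , a , y≢p₁ , y≢w =
      inj₁ (chord A K (inner (before-last (p₁ ∷ A) B (maximal y∈S a) a away)) (adj-sym a))
      where
      K : Cycle p₀ (p₁ ∷ A ++ [ w ])
      K = close-path A (uniq-prefix (p₀ ∷ p₁ ∷ A) w B u) (path-++ˡ (p₀ ∷ p₁ ∷ A) w B path) (adj-sym aw)
      inner : y ∈ p₁ ∷ A ++ [ w ] → y ∈ A
      inner (here e) = ⊥-elim (y≢p₁ e)
      inner (there q) with ∈-++⁻ A q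
      ... | inj₁ r = r
      ... | inj₂ (here e) = ⊥-elim (y≢w e)
    last-neighbour {p₀} {p₁} {w} A B u in-S path maximal aw away | no no-third =
      remove-degree-two A K (λ q → in-S (∈-prefix (p₀ ∷ p₁ ∷ A) q)) only
      where
      K : Cycle p₀ (p₁ ∷ A ++ [ w ])
      K = close-path A (uniq-prefix (p₀ ∷ p₁ ∷ A) w B u) (path-++ˡ (p₀ ∷ p₁ ∷ A) w B path) (adj-sym aw)
      only : ∀ {y} → y ∈ S → Adj p₀ y → y ≡ p₁ ⊎ y ≡ w
      only {y} y∈S a with y ≟ p₁ | y ≟ w
      ... | yes e   | _      = inj₁ e
      ... | no _    | yes e  = inj₂ e
      ... | no y≢p₁ | no y≢w = ⊥-elim (no-third (lose y∈S (a , y≢p₁ , y≢w)))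

    -- If every vertex has degree at least two, follow a maximal path from some
    -- vertex p₀.  All neighbours of p₀ lie on it; as p₀ has two of them, the
    -- last one w is not the second vertex of the path.
    no-leaf : (∀ {u} → u ∈ S → 2 ≤ deg u S) → Outcome (suc n) S U
    no-leaf two with maximal-path S (proj₂ (nonempty S len))
    ... | mkMaximalPath p₀ T u in-S path maximal
      with count-2 (E p₀) us (two (in-S (here refl))) | lastSplit (Adj? p₀) T
    ... | y₁ , _ , y₁∈S , _ , a₁ , _ | none away with maximal y₁∈S a₁
    ...   | here refl = ⊥-elim (adj-irr a₁ refl)
    ...   | there q   = ⊥-elim (All.lookup away q a₁)
    no-leaf two | mkMaximalPath p₀ _ u in-S path maximal
      | y₁ , y₂ , y₁∈S , y₂∈S , a₁ , a₂ , y₁≢y₂ | last [] w B aw away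
      with before-last [] B (maximal y₁∈S a₁) a₁ away | before-last [] B (maximal y₂∈S a₂) a₂ away
    ... | here refl | here refl = ⊥-elim (y₁≢y₂ refl)
    no-leaf two | mkMaximalPath p₀ _ u in-S path maximal | _ | last (p₁ ∷ A) w B aw away =
      last-neighbour A B u in-S path maximal aw away

  edge-bound : ∀ n → Bound n
  edge-bound zero [] () us U uU U⊆S hot
  edge-bound zero (s ∷ _ ∷ _) () us U uU U⊆S hot
  edge-bound zero (s ∷ []) len us U uU U⊆S hot =
    inj₂ (s≤s (s≤s (s≤s (length≤1 s uU (λ q → singleton (U⊆S q))))))
    where
    singleton : ∀ {w} → w ∈ s ∷ [] → w ≡ s
    singleton (here refl) = refl
  edge-bound (suc n) S len us U uU U⊆S hot with any? (λ u → deg u S ≤? 1) S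
  ... | yes leaf with find leaf
  ...   | u , u∈S , d = Step.remove-leaf n (edge-bound n) S len us U uU U⊆S hot u∈S d
  edge-bound (suc n) S len us U uU U⊆S hot | no no-leaf =
    Step.no-leaf n (edge-bound n) S len us U uU U⊆S hot
      (λ u∈S → ≰⇒> (λ d → no-leaf (lose u∈S d)))

  few-edges : ∀ n S → length S ≡ suc n → Uniq S → EvenTrail ⊎ (3 * edgeCount S + 3 ≤ 4 * suc n)
  few-edges n S len us = map₂ (subst (_≤ 4 * suc n) (+-identityʳ _))
    (edge-bound n S len us [] [] (λ ()) (λ ()))

module TradeGraph (v : ℕ) (D : Subset v → Bool) (D⊆F : IsSubsetOfFull v 3 D)
  (a b : Fin v) (a≢b : a ≢ b) where

  off-ab : Fin v → Bool
  off-ab i = not (i == a) ∧ not (i == b)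

  E : Fin v → Fin v → Bool
  E i j = not (i == j) ∧ (off-ab i ∧ (off-ab j ∧ (not (D (triple i j a)) ∧ not (D (triple i j b)))))

  E-sym : ∀ x y → E x y ≡ E y x
  E-sym x y rewrite ==-sym x y | triple-swap x y a | triple-swap x y b with off-ab x | off-ab y
  ... | true  | true  = refl
  ... | true  | false = refl
  ... | false | true  = refl
  ... | false | false = refl

  E-irr : ∀ x → E x x ≡ false
  E-irr x rewrite ==-refl x = refl

  open EvenTrails F._≟_ E E-sym E-irr public

  record EdgeFacts (u w : Fin v) : Set where
    field
      u≠w : (u == w) ≡ false
      u≠a : (u == a) ≡ false
      u≠b : (u == b) ≡ false
      w≠a : (w == a) ≡ false
      w≠b : (w == b) ≡ false
      a-block∉D : D (triple u w a) ≡ false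
      b-block∉D : D (triple u w b) ≡ false

  edge-facts : ∀ u w → Adj u w → EdgeFacts u w
  edge-facts u w e with ∧-true e
  ... | u≠w , rest₁ with ∧-true rest₁
  ... | off-u , rest₂ with ∧-true rest₂ | ∧-true off-u
  ... | off-w , rest₃ | u≠a , u≠b with ∧-true rest₃ | ∧-true off-w
  ... | a∉D , b∉D | w≠a , w≠b = record
    { u≠w = not-true u≠w ; u≠a = not-true u≠a ; u≠b = not-true u≠b
    ; w≠a = not-true w≠a ; w≠b = not-true w≠b
    ; a-block∉D = not-true a∉D ; b-block∉D = not-true b∉D }

  -- The blocks of the trade are {u,w,c} for an edge uw and c ∈ {a,b}.
  AB : Fin v → Set
  AB c = c ≡ a ⊎ c ≡ b

  ends≠ : ∀ u w {c} → Adj u w → AB c → (u == c) ≡ false × (w == c) ≡ false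
  ends≠ u w e (inj₁ refl) = EdgeFacts.u≠a (edge-facts u w e) , EdgeFacts.w≠a (edge-facts u w e)
  ends≠ u w e (inj₂ refl) = EdgeFacts.u≠b (edge-facts u w e) , EdgeFacts.w≠b (edge-facts u w e)

  block∉D : ∀ u w {c} → Adj u w → AB c → D (triple u w c) ≡ false
  block∉D u w e (inj₁ refl) = EdgeFacts.a-block∉D (edge-facts u w e)
  block∉D u w e (inj₂ refl) = EdgeFacts.b-block∉D (edge-facts u w e)

  block-size : ∀ u w {c} → Adj u w → AB c → ∣ triple u w c ∣ ≡ 3
  block-size u w {c} e hc = ∣triple∣ u w c (adj-irr {u} {w} e)
    (λ { refl → true≢false (trans (sym (==-refl u)) (proj₁ (ends≠ u w e hc))) })
    (λ { refl → true≢false (trans (sym (==-refl w)) (proj₂ (ends≠ u w e hc))) })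

  in-block : ∀ {x u w c : Fin v} → lookup (triple u w c) x ≡ true → (x == c) ≡ false → x ≡ u ⊎ x ≡ w
  in-block {x} {u} {w} {c} x∈ x≠c
    with (x == u) in eu | (x == w) in ew | trans (sym (lookup-triple x u w c)) x∈
  ... | true  | _     | _ = inj₁ (==-sound eu)
  ... | false | true  | _ = inj₂ (==-sound ew)
  ... | false | false | x=c = ⊥-elim (true≢false (trans (sym x=c) x≠c))

  block-has : ∀ (x u w c : Fin v) → x ≡ u ⊎ x ≡ w ⊎ x ≡ c → lookup (triple u w c) x ≡ true
  block-has x u w c h rewrite lookup-triple x u w c with h
  ... | inj₁ refl rewrite ==-refl x = refl
  ... | inj₂ (inj₁ refl) rewrite ==-refl x = ∨-zeroʳ (x == u)
  ... | inj₂ (inj₂ refl) rewrite ==-refl x | ∨-zeroʳ (x == w) = ∨-zeroʳ (x == u)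

  block-edge : ∀ {x y u w c d} → Adj x y → Adj u w → AB c → AB d →
    triple x y c ≡ triple u w d → Same (x , y) (u , w)
  block-edge {x} {y} {u} {w} {c} {d} axy auw hc hd eq
    with in-block {x} {u} {w} {d} (trans (cong (λ T → lookup T x) (sym eq)) (block-has x x y c (inj₁ refl)))
           (proj₁ (ends≠ x y axy hd))
       | in-block {y} {u} {w} {d} (trans (cong (λ T → lookup T y) (sym eq)) (block-has y x y c (inj₂ (inj₁ refl))))
           (proj₂ (ends≠ x y axy hd))
  ... | inj₁ refl | inj₂ refl = inj₁ (refl , refl)
  ... | inj₂ refl | inj₁ refl = inj₂ (refl , refl)
  ... | inj₁ refl | inj₁ refl = ⊥-elim (adj-irr {x} {y} axy refl)
  ... | inj₂ refl | inj₂ refl = ⊥-elim (adj-irr {x} {y} axy refl)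

  alt : Fin v → Fin v → List (Fin v) → Subset v → ℕ
  alt c c′ (x ∷ y ∷ r) B = single (triple x y c) B + alt c′ c (y ∷ r) B
  alt c c′ _           B = 0

  alt-zero : ∀ c c′ W B →
    (∀ {u w} → (u , w) ∈ edges W → (B =ˢ triple u w c) ≡ false × (B =ˢ triple u w c′) ≡ false) →
    alt c c′ W B ≡ 0
  alt-zero c c′ []                B h = refl
  alt-zero c c′ (x ∷ [])          B h = refl
  alt-zero c c′ (x ∷ W@(y ∷ r))   B h = cong₂ _+_ (cong bit (proj₁ (h (here refl))))
    (alt-zero c′ c W B (λ q → let (p₁ , p₂) = h (there q) in p₂ , p₁))

  FromEdge : Fin v → Fin v → List (Fin v) → Subset v → Set
  FromEdge c c′ W B = Σ[ u ∈ Fin v ] Σ[ w ∈ Fin v ] (u , w) ∈ edges W × (B ≡ triple u w c ⊎ B ≡ triple u w c′)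

  first-or-rest : ∀ e {n} → 1 ≤ bit e + n → e ≡ true ⊎ 1 ≤ n
  first-or-rest true  _ = inj₁ refl
  first-or-rest false h = inj₂ h

  alt-from-edge : ∀ c c′ W B → 1 ≤ alt c c′ W B → FromEdge c c′ W B
  alt-from-edge c c′ (x ∷ y ∷ r) B h =
    [ (λ eq → x , y , here refl , inj₁ (=ˢ-sound B _ eq)) , later ∘ alt-from-edge c′ c (y ∷ r) B ]′
      (first-or-rest (B =ˢ triple x y c) h)
    where
    later : FromEdge c′ c (y ∷ r) B → FromEdge c c′ (x ∷ y ∷ r) B
    later (u , w , q , inj₁ e) = u , w , there q , inj₂ e
    later (u , w , q , inj₂ e) = u , w , there q , inj₁ e

  alt-≤1 : ∀ c c′ W B → AB c → AB c′ → Path W → AllPairs NotSame (edges W) → alt c c′ W B ≤ 1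
  alt-≤1 c c′ []              B hc hc′ p d = z≤n
  alt-≤1 c c′ (x ∷ [])        B hc hc′ p d = z≤n
  alt-≤1 c c′ (x ∷ W@(y ∷ r)) B hc hc′ (axy , p) (new ∷ d) with B =ˢ triple x y c in eq
  ... | false = alt-≤1 c′ c W B hc′ hc p d
  ... | true  = s≤s (≤-reflexive (alt-zero c′ c W B (λ q → other q hc′ , other q hc)))
    where
    other : ∀ {u w d} → (u , w) ∈ edges W → AB d → (B =ˢ triple u w d) ≡ false
    other {u} {w} {d} q hd = =ˢ-false B (triple u w d) (λ B≡ → All.lookup new q
      (block-edge axy (edge-adj W p q) hc hd (trans (sym (=ˢ-sound B _ eq)) B≡)))

  alt-D : ∀ c c′ W B → AB c → AB c′ → Path W → D B ≡ true → alt c c′ W B ≡ 0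
  alt-D c c′ W B hc hc′ p B∈D = alt-zero c c′ W B (λ q → not-D q hc , not-D q hc′)
    where
    not-D : ∀ {u w d} → (u , w) ∈ edges W → AB d → (B =ˢ triple u w d) ≡ false
    not-D {u} {w} {d} q hd = =ˢ-false B (triple u w d)
      (λ { refl → true≢false (trans (sym B∈D) (block∉D u w (edge-adj W p q) hd)) })

  alt-size : ∀ c c′ W B → AB c → AB c′ → Path W → 1 ≤ alt c c′ W B → ∣ B ∣ ≡ 3
  alt-size c c′ W B hc hc′ p h with alt-from-edge c c′ W B h
  ... | u , w , q , inj₁ refl = block-size u w (edge-adj W p q) hc
  ... | u , w , q , inj₂ refl = block-size u w (edge-adj W p q) hc′

  covers : Fin v → Fin v → Fin v → Fin v → Fin v → ℕ
  covers x y c u w = bit (lookup (triple u w c) x ∧ lookup (triple u w c) y)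

  alt-pairCount : ∀ x y c c′ W →
    pairCount (alt c c′ W) x y ≡ evenSum (covers x y c) W + oddSum (covers x y c′) W
  alt-pairCount x y c c′ []       = pairCount-0 (alt c c′ []) x y (λ _ → refl)
  alt-pairCount x y c c′ (u ∷ []) = pairCount-0 (alt c c′ (u ∷ [])) x y (λ _ → refl)
  alt-pairCount x y c c′ (u ∷ W@(w ∷ r)) =
    trans (pairCount-+ (single (triple u w c)) (alt c′ c W) x y)
      (trans (cong₂ _+_ (pairCount-single (triple u w c) x y) (alt-pairCount x y c′ c W))
        (regroup (covers x y c u w) (evenSum (covers x y c′) W) (oddSum (covers x y c) W)))
    where
    regroup : ∀ p q r → p + (q + r) ≡ (p + r) + q
    regroup = solve-∀

  touches : Fin v → Fin v → Fin v → Bool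
  touches z u w = (z == u) ∨ (z == w)

  touches-c : ∀ z u w c → Adj u w → AB c → (touches z u w ∧ (z == c)) ≡ false
  touches-c z u w c e hc with z == c in z=c
  ... | false = ∧-zeroʳ (touches z u w)
  ... | true with ==-sound {i = z} {c} z=c
  ... | refl rewrite ==-sym z u | ==-sym z w | proj₁ (ends≠ u w e hc) | proj₂ (ends≠ u w e hc) = refl

  covers-split : ∀ x y → x ≢ y → ∀ c → AB c → ∀ u w → Adj u w →
    covers x y c u w ≡ bit (touches x u w ∧ touches y u w)
                       + bit (touches x u w) * bit (y == c) + bit (x == c) * bit (touches y u w)
  covers-split x y x≢y c hc u w e
    rewrite lookup-triple x u w c | lookup-triple y u w c
          | sym (∨-assoc (x == u) (x == w) (x == c)) | sym (∨-assoc (y == u) (y == w) (y == c)) =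
    three-cases (touches x u w) (x == c) (touches y u w) (y == c)
      (touches-c x u w c e hc) (touches-c y u w c e hc) not-both
    where
    not-both : ((x == c) ∧ (y == c)) ≡ false
    not-both with x == c in x=c | y == c in y=c
    ... | false | _     = refl
    ... | true  | false = refl
    ... | true  | true  = ⊥-elim (x≢y (trans (==-sound x=c) (sym (==-sound y=c))))
    three-cases : ∀ p q r s → (p ∧ q) ≡ false → (r ∧ s) ≡ false → (q ∧ s) ≡ false →
      bit ((p ∨ q) ∧ (r ∨ s)) ≡ bit (p ∧ r) + bit p * bit s + bit q * bit r
    three-cases true  true  _     _     ()   _  _
    three-cases true  false true  true  _    () _
    three-cases true  false true  false _    _  _ = refl
    three-cases true  false false true  _    _  _ = refl
    three-cases true  false false false _    _  _ = refl
    three-cases false true  _     true  _    _  ()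
    three-cases false true  true  false _    _  _ = refl
    three-cases false true  false false _    _  _ = refl
    three-cases false false true  true  _    () _
    three-cases false false true  false _    _  _ = refl
    three-cases false false false true  _    _  _ = refl
    three-cases false false false false _    _  _ = refl

  touches-balanced : ∀ z w R → Path (w ∷ R ++ [ w ]) → even? (suc (length R)) ≡ true →
    evenSum (λ u w′ → bit (touches z u w′)) (w ∷ R ++ [ w ])
      ≡ oddSum (λ u w′ → bit (touches z u w′)) (w ∷ R ++ [ w ])
  touches-balanced z w R p e =
    trans (evenSum-cong _ p as-ends) (trans (Telescope.balance (λ u → bit (z == u)) w R e)
      (sym (oddSum-cong _ p as-ends)))
    where
    as-ends : ∀ u w′ → Adj u w′ → bit (touches z u w′) ≡ bit (z == u) + bit (z == w′)
    as-ends u w′ e with z == u in z=u | z == w′ in z=w′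
    ... | false | _     = refl
    ... | true  | false = refl
    ... | true  | true  = ⊥-elim (adj-irr {u} {w′} e (trans (sym (==-sound z=u)) (==-sound z=w′)))

  module _ (x y : Fin v) (x≢y : x ≢ y) where
    both tx ty : Fin v → Fin v → ℕ
    both u w = bit (touches x u w ∧ touches y u w)
    tx u w = bit (touches x u w)
    ty u w = bit (touches y u w)

    evenSum-covers : ∀ c → AB c → ∀ W → Path W → evenSum (covers x y c) W
      ≡ evenSum both W + evenSum tx W * bit (y == c) + bit (x == c) * evenSum ty W
    evenSum-covers c hc W p = trans (evenSum-cong W p (covers-split x y x≢y c hc))
      (trans (evenSum-+ _ _ W) (cong₂ _+_
        (trans (evenSum-+ _ _ W) (cong (evenSum both W +_) (evenSum-*ʳ tx (bit (y == c)) W)))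
        (evenSum-*ˡ ty (bit (x == c)) W)))

    oddSum-covers : ∀ c → AB c → ∀ W → Path W → oddSum (covers x y c) W
      ≡ oddSum both W + oddSum tx W * bit (y == c) + bit (x == c) * oddSum ty W
    oddSum-covers c hc W p = trans (oddSum-cong W p (covers-split x y x≢y c hc))
      (trans (oddSum-+ _ _ W) (cong₂ _+_
        (trans (oddSum-+ _ _ W) (cong (oddSum both W +_) (oddSum-*ʳ tx (bit (y == c)) W)))
        (oddSum-*ˡ ty (bit (x == c)) W)))

    alt-swap : ∀ W → Path W → evenSum tx W ≡ oddSum tx W → evenSum ty W ≡ oddSum ty W →
      pairCount (alt a b W) x y ≡ pairCount (alt b a W) x y
    alt-swap W p ex ey
      rewrite alt-pairCount x y a b W | alt-pairCount x y b a W
            | evenSum-covers a (inj₁ refl) W p | evenSum-covers b (inj₂ refl) W p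
            | oddSum-covers a (inj₁ refl) W p | oddSum-covers b (inj₂ refl) W p | ex | ey =
      swap (evenSum both W) (oddSum both W) (oddSum tx W) (oddSum ty W)
           (bit (y == a)) (bit (y == b)) (bit (x == a)) (bit (x == b))
      where
      swap : ∀ e o s t ya yb xa xb →
        e + s * ya + xa * t + (o + s * yb + xb * t) ≡ e + s * yb + xb * t + (o + s * ya + xa * t)
      swap = solve-∀

  snoc≢[] : ∀ {A : Set} (R : List A) {x : A} → R ++ [ x ] ≢ []
  snoc≢[] []      ()
  snoc≢[] (_ ∷ _) ()

  module TradeAlong (tr : EvenTrail) where
    W : List (Fin v)
    W = start tr ∷ route tr ++ [ start tr ]

    removed added traded : Subset v → ℕ
    removed = alt a b W
    added   = alt b a W
    traded B = Full v 3 B + added B ∸ removed B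

    removed≤Full : ∀ B → removed B ≤ Full v 3 B
    removed≤Full B with removed B in e
    ... | zero  = z≤n
    ... | suc k = subst (suc k ≤_)
      (sym (Full-k B (alt-size a b W B (inj₁ refl) (inj₂ refl) (trail-path tr) (subst (1 ≤_) (sym e) (s≤s z≤n)))))
      (subst (_≤ 1) e (alt-≤1 a b W B (inj₁ refl) (inj₂ refl) (trail-path tr) (trail-distinct tr)))

    traded+removed : ∀ B → traded B + removed B ≡ Full v 3 B + added B
    traded+removed B = m∸n+n≡m (≤-trans (removed≤Full B) (m≤m+n (Full v 3 B) (added B)))

    traded-size : ∀ B → 0 < traded B → ∣ B ∣ ≡ 3
    traded-size B h with Full v 3 B in eF | added B in eA
    ... | suc _ | _     = Full-size B (subst (1 ≤_) (sym eF) (s≤s z≤n))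
    ... | zero  | suc _ = alt-size b a W B (inj₂ refl) (inj₁ refl) (trail-path tr) (subst (1 ≤_) (sym eA) (s≤s z≤n))
    ... | zero  | zero rewrite 0∸n≡0 (removed B) with h
    ...   | ()

    -- Every pair keeps its count, because the trail is closed and even.
    traded-pairs : ∀ x y → x ≢ y → pairCount traded x y ≡ (v ∸ 2) C (3 ∸ 2)
    traded-pairs x y x≢y = +-cancelʳ-≡ (pairCount removed x y) _ _ (begin
      pairCount traded x y + pairCount removed x y
        ≡⟨ sym (pairCount-+ traded removed x y) ⟩
      pairCount (λ B → traded B + removed B) x y
        ≡⟨ pairCount-cong _ _ x y traded+removed ⟩
      pairCount (λ B → Full v 3 B + added B) x y
        ≡⟨ pairCount-+ (Full v 3) added x y ⟩
      pairCount (Full v 3) x y + pairCount added x y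
        ≡⟨ cong₂ _+_ (pairCount-Full v x y x≢y) (sym (alt-swap x y x≢y W (trail-path tr)
             (touches-balanced x (start tr) (route tr) (trail-path tr) (trail-even tr))
             (touches-balanced y (start tr) (route tr) (trail-path tr) (trail-even tr)))) ⟩
      (v ∸ 2) C (3 ∸ 2) + pairCount removed x y ∎)
      where open ≡-Reasoning

    traded-design : IsDesign v 3 ((v ∸ 2) C (3 ∸ 2)) traded
    traded-design = traded-size , traded-pairs

    traded-contains : Contains D traded
    traded-contains B B∈D rewrite alt-D a b W B (inj₁ refl) (inj₂ refl) (trail-path tr) B∈D
                                | Full-k B (D⊆F B B∈D) = s≤s z≤n

    -- The first block {w₀,w₁,a} of the trail is removed and not added back.
    traded-differs : Σ[ B ∈ Subset v ] traded B ≢ Full v 3 B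
    traded-differs with route tr ++ [ start tr ] in eq | trail-path tr | trail-distinct tr
    ... | [] | _ | _ = ⊥-elim (snoc≢[] (route tr) eq)
    ... | w₁ ∷ r | first , rest | new ∷ _ = B₀ , differs
      where
      w₀ = start tr
      B₀ = triple w₀ w₁ a
      not-b : ∀ u w → (B₀ =ˢ triple u w b) ≡ false
      not-b u w = =ˢ-false B₀ (triple u w b) λ B₀≡ → true≢false
        (trans (sym (block-has b u w b (inj₂ (inj₂ refl))))
          (trans (cong (λ B → lookup B b) (sym B₀≡)) b∉B₀))
        where
        b∉B₀ : lookup B₀ b ≡ false
        b∉B₀ rewrite lookup-triple b w₀ w₁ a | ==-sym b w₀ | ==-sym b w₁
                   | EdgeFacts.u≠b (edge-facts w₀ w₁ first) | EdgeFacts.w≠b (edge-facts w₀ w₁ first)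
                   | ==-≢ (a≢b ∘ sym) = refl
      not-later-a : ∀ {u w} → (u , w) ∈ edges (w₁ ∷ r) → (B₀ =ˢ triple u w a) ≡ false
      not-later-a {u} {w} q = =ˢ-false B₀ (triple u w a) λ B₀≡ → All.lookup new q
        (block-edge first (edge-adj (w₁ ∷ r) rest q) (inj₁ refl) (inj₁ refl) B₀≡)
      removed-B₀ : alt a b (w₀ ∷ w₁ ∷ r) B₀ ≡ 1
      removed-B₀ = cong₂ _+_ (cong bit (=ˢ-refl B₀))
        (alt-zero b a (w₁ ∷ r) B₀ (λ {u} {w} q → not-b u w , not-later-a q))
      added-B₀ : alt b a (w₀ ∷ w₁ ∷ r) B₀ ≡ 0
      added-B₀ = cong₂ _+_ (cong bit (not-b w₀ w₁))
        (alt-zero a b (w₁ ∷ r) B₀ (λ {u} {w} q → not-later-a q , not-b u w))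
      B₀-full : Full v 3 B₀ ≡ 1
      B₀-full = Full-k B₀ (block-size w₀ w₁ first (inj₁ refl))
      traded-B₀ : Full v 3 B₀ + alt b a (w₀ ∷ w₁ ∷ r) B₀ ∸ alt a b (w₀ ∷ w₁ ∷ r) B₀ ≡ 0
      traded-B₀ = cong₂ _∸_ (cong₂ _+_ B₀-full added-B₀) removed-B₀
      differs : Full v 3 B₀ + alt b a (w₀ ∷ w₁ ∷ r) B₀ ∸ alt a b (w₀ ∷ w₁ ∷ r) B₀ ≢ Full v 3 B₀
      differs e with trans (sym traded-B₀) (trans e B₀-full)
      ... | ()

  not-defining : EvenTrail → ¬ IsDefiningSet v 3 D
  not-defining tr defining with TradeAlong.traded-differs tr
  ... | B , differs = differs (defining traded traded-design traded-contains B)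
    where open TradeAlong tr

  -- s_{a,b}(D) is the number of edges of G.  The pairs counted by sCount are
  -- ordered by toℕ, so we count edges ij with i before j in the list allFin v.
  before : Fin v → Fin v → Bool
  before i j = toℕ i <ᵇ toℕ j

  before-≢ : ∀ i j → before i j ≡ true → i ≢ j
  before-≢ i j e refl = irreflexive (toℕ i) e
    where
    irreflexive : ∀ n → (n <ᵇ n) ≡ true → ⊥
    irreflexive zero    ()
    irreflexive (suc n) e = irreflexive n e

  before-asym : ∀ i j → before i j ≡ true → before j i ≡ false
  before-asym i j = asym (toℕ i) (toℕ j)
    where
    asym : ∀ m n → (m <ᵇ n) ≡ true → (n <ᵇ m) ≡ false
    asym zero    (suc n) e = refl
    asym (suc m) (suc n) e = asym m n e

  good-pair : Fin v × Fin v → Bool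
  good-pair (i , j) =
        ⌊ toℕ i <? toℕ j ⌋
        ∧ not ⌊ i F.≟ a ⌋ ∧ not ⌊ i F.≟ b ⌋ ∧ not ⌊ j F.≟ a ⌋ ∧ not ⌊ j F.≟ b ⌋
        ∧ not (D (triple i j a)) ∧ not (D (triple i j b))

  good-pair-edge : ∀ i j → good-pair (i , j) ≡ (before i j ∧ E i j)
  good-pair-edge i j rewrite ⌊<?⌋ (toℕ i) (toℕ j)
    with before i j in lt
  ... | false = refl
  ... | true rewrite ==-≢ (before-≢ i j lt) =
    regroup (not (i == a)) (not (i == b)) (not (j == a)) (not (j == b))
            (not (D (triple i j a))) (not (D (triple i j b)))
    where
    regroup : ∀ p q r s t u → (p ∧ q ∧ r ∧ s ∧ t ∧ u) ≡ ((p ∧ q) ∧ (r ∧ s) ∧ t ∧ u)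
    regroup true  true  true  s t u = refl
    regroup true  true  false s t u = refl
    regroup true  false r     s t u = refl
    regroup false q     r     s t u = refl

  length-filter : ∀ (f : Fin v × Fin v → Bool) xs →
    length (filter (λ p → f p Bool.≟ true) xs) ≡ sum (map (bit ∘ f) xs)
  length-filter f []       = refl
  length-filter f (p ∷ ps) with f p
  ... | true  = cong suc (length-filter f ps)
  ... | false = length-filter f ps

  ordered-edges : List (Fin v) → ℕ
  ordered-edges L = sum (map (λ i → sum (map (λ j → bit (before i j ∧ E i j)) L)) L)

  sCount-edges : sCount D a b ≡ ordered-edges (allFin v)
  sCount-edges = begin
    sCount D a b
      ≡⟨ length-filter good-pair pairs ⟩
    sum (map (bit ∘ good-pair) pairs)
      ≡⟨ double-sum (allFin v) ⟩
    sum (map (λ i → sum (map (λ j → bit (good-pair (i , j))) (allFin v))) (allFin v))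
      ≡⟨ cong sum (map-cong (λ i → cong sum (map-cong (λ j → cong bit (good-pair-edge i j)) (allFin v))) (allFin v)) ⟩
    ordered-edges (allFin v) ∎
    where
    open ≡-Reasoning
    pairs = concatMap (λ i → map (λ j → (i , j)) (allFin v)) (allFin v)
    double-sum : ∀ L → sum (map (bit ∘ good-pair) (concatMap (λ i → map (λ j → (i , j)) (allFin v)) L))
                     ≡ sum (map (λ i → sum (map (λ j → bit (good-pair (i , j))) (allFin v))) L)
    double-sum []      = refl
    double-sum (i ∷ L) =
      trans (cong sum (map-++ (bit ∘ good-pair) (map (λ j → (i , j)) (allFin v)) _))
        (trans (sum-++ (map (bit ∘ good-pair) (map (λ j → (i , j)) (allFin v))) _)
          (cong₂ _+_ (cong sum (sym (map-∘ (allFin v)))) (double-sum L)))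

  Increasing : ∀ {n} → List (Fin n) → Set
  Increasing []      = ⊤
  Increasing (x ∷ L) = All (λ j → (toℕ x <ᵇ toℕ j) ≡ true) L × Increasing L

  increasing-allFin : ∀ n → Increasing (allFin n)
  increasing-allFin zero    = tt
  increasing-allFin (suc n) = subst Increasing (sym allFin-suc)
    (zero-first (allFin n) , increasing-suc (allFin n) (increasing-allFin n))
    where
    allFin-suc : allFin (suc n) ≡ zero ∷ map suc (allFin n)
    allFin-suc = cong (zero ∷_) (sym (map-tabulate (λ i → i) suc))
    zero-first : ∀ (L : List (Fin n)) → All (λ j → (toℕ (zero {n}) <ᵇ toℕ j) ≡ true) (map suc L)
    zero-first []      = []
    zero-first (_ ∷ L) = refl ∷ zero-first L
    increasing-suc : ∀ (L : List (Fin n)) → Increasing L → Increasing (map suc L)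
    increasing-suc []      _          = tt
    increasing-suc (x ∷ L) (after , inc) = shift L after , increasing-suc L inc
      where
      shift : ∀ L → All (λ j → (toℕ x <ᵇ toℕ j) ≡ true) L →
                    All (λ j → (toℕ (suc x) <ᵇ toℕ j) ≡ true) (map suc L)
      shift []      []        = []
      shift (_ ∷ L) (e ∷ all) = e ∷ shift L all

  increasing-uniq : ∀ L → Increasing {v} L → Uniq L
  increasing-uniq []      _           = []
  increasing-uniq (x ∷ L) (after , inc) =
    (λ q → before-≢ x x (All.lookup after q) refl) ∷ increasing-uniq L inc

  edgeCount-increasing : ∀ L → Increasing {v} L → edgeCount L ≡ ordered-edges L
  edgeCount-increasing []      _             = refl
  edgeCount-increasing (x ∷ L) (after , inc) = sym (begin
    (bit (before x x ∧ E x x) + sum (map (λ j → bit (before x j ∧ E x j)) L))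
      + sum (map (λ i → bit (before i x ∧ E i x) + sum (map (λ j → bit (before i j ∧ E i j)) L)) L)
      ≡⟨ cong₂ _+_ (cong (λ t → bit (t ∧ E x x) + sum (map (λ j → bit (before x j ∧ E x j)) L)) (before-irr x))
                   (sum-map-+ (λ i → bit (before i x ∧ E i x))
                              (λ i → sum (map (λ j → bit (before i j ∧ E i j)) L)) L) ⟩
    sum (map (λ j → bit (before x j ∧ E x j)) L)
      + (sum (map (λ i → bit (before i x ∧ E i x)) L) + ordered-edges L)
      ≡⟨ cong₂ _+_ (later-neighbours L after)
                   (cong (_+ ordered-edges L) (sum-map-0 (λ i → bit (before i x ∧ E i x)) L (λ {i} q → cong (λ t → bit (t ∧ E i x)) (before-asym x i (All.lookup after q))))) ⟩
    deg x L + ordered-edges L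
      ≡⟨ cong (deg x L +_) (sym (edgeCount-increasing L inc)) ⟩
    edgeCount (x ∷ L) ∎)
    where
    open ≡-Reasoning
    before-irr : ∀ x → before x x ≡ false
    before-irr x with before x x in e
    ... | false = refl
    ... | true  = ⊥-elim (before-≢ x x e refl)
    later-neighbours : ∀ L → All (λ j → before x j ≡ true) L →
      sum (map (λ j → bit (before x j ∧ E x j)) L) ≡ deg x L
    later-neighbours []      []          = refl
    later-neighbours (j ∷ L) (e ∷ after) rewrite e = cong (bit (E x j) +_) (later-neighbours L after)

  points : List (Fin v)
  points = rm b (rm a (allFin v))

  allFin-uniq : Uniq (allFin v)
  allFin-uniq = increasing-uniq (allFin v) (increasing-allFin v)

  b∈rm-a : b ∈ rm a (allFin v)
  b∈rm-a = rm-∈ a (allFin v) (∈-allFin b) (a≢b ∘ sym)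

  points-uniq : Uniq points
  points-uniq = rm-uniq b (rm-uniq a allFin-uniq)

  points-length : suc (suc (length points)) ≡ v
  points-length = trans (cong suc (sym (rm-length b (rm-uniq a allFin-uniq) b∈rm-a)))
    (trans (sym (rm-length a allFin-uniq (∈-allFin a))) (length-tabulate (λ i → i)))

  -- a and b are isolated, so deleting them loses no edges.
  isolated : ∀ c → off-ab c ≡ false → ∀ j → E c j ≡ false
  isolated c e j rewrite e = ∧-zeroʳ (not (c == j))

  edgeCount-points : edgeCount points ≡ sCount D a b
  edgeCount-points = sym (begin
    sCount D a b                                   ≡⟨ sCount-edges ⟩
    ordered-edges (allFin v)                       ≡⟨ sym (edgeCount-increasing (allFin v) (increasing-allFin v)) ⟩
    edgeCount (allFin v)                           ≡⟨ edgeCount-rm a allFin-uniq (∈-allFin a) ⟩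
    deg a (rm a (allFin v)) + edgeCount (rm a (allFin v))
      ≡⟨ cong (_+ edgeCount (rm a (allFin v))) (count-zero (E a) (rm a (allFin v)) (λ {j} _ → isolated a a-off j)) ⟩
    edgeCount (rm a (allFin v))                    ≡⟨ edgeCount-rm b (rm-uniq a allFin-uniq) b∈rm-a ⟩
    deg b points + edgeCount points
      ≡⟨ cong (_+ edgeCount points) (count-zero (E b) points (λ {j} _ → isolated b b-off j)) ⟩
    edgeCount points                               ∎)
    where
    open ≡-Reasoning
    a-off : off-ab a ≡ false
    a-off rewrite ==-refl a = refl
    b-off : off-ab b ≡ false
    b-off rewrite ==-refl b = ∧-zeroʳ (not (b == a))

-- For v = m + 4 the graph G has m + 2 vertices, and 3e + 3 ≤ 4(m + 2) says
-- exactly that e ≤ ⌊(4v - 11)/3⌋.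
edges≤bound : ∀ m e → 3 * e + 3 ≤ 4 * suc (suc m) → e ≤ (4 * suc (suc (suc (suc m))) ∸ 11) / 3
edges≤bound m e few = subst (_≤ _) (m*n/n≡m e 3) (/-monoˡ-≤ 3 e*3≤)
  where
  e*3≤ : e * 3 ≤ 4 * suc (suc (suc (suc m))) ∸ 11
  e*3≤ = subst₂ _≤_ (*-comm 3 e) (sym (trans (cong (_∸ 11) (split-11 m)) (m+n∸m≡n 11 (4 * m + 5))))
    (+-cancelʳ-≤ 3 (3 * e) (4 * m + 5) (subst (3 * e + 3 ≤_) (split-3 m) few))
    where
    split-11 : ∀ m → 4 * suc (suc (suc (suc m))) ≡ 11 + (4 * m + 5)
    split-11 = solve-∀
    split-3 : ∀ m → 4 * suc (suc m) ≡ 4 * m + 5 + 3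
    split-3 = solve-∀

lemma3p2 : (v : ℕ) → 4 ≤ v → (D : Subset v → Bool) → IsSubsetOfFull v 3 D →
    Σ[ a ∈ Fin v ] Σ[ b ∈ Fin v ] (a ≢ b × (4 * v ∸ 11) / 3 < sCount D a b) →
    ¬ IsDefiningSet v 3 D
lemma3p2 v (s≤s (s≤s (s≤s (s≤s {n = m} _)))) D D⊆F (a , b , a≢b , many) =
  [ not-defining
  , (λ few → ⊥-elim (<⇒≱ many (subst (_≤ _) edgeCount-points (edges≤bound m _ few))))
  ]′ (few-edges (suc m) points (suc-injective (suc-injective points-length)) points-uniq)
  where open TradeGraph v D D⊆F a b a≢b
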